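{- Let $I=(V,\mathcal{C},k)$ be an irreducible instance of 2-Linear Ordering. If $I$ is a no-instance, then $|V|<10k$.
   Context: 2-Linear Ordering: an instance $(V,\mathcal{C},k)$ consists of a finite variable set $V$, a multiset $\mathcal{C}$ of binary constraints $e=(e(1),e(2))$ (ordered pairs of distinct variables) with integer weights $w(e)\ge0$, and an integer $k\ge0$. A linear ordering $\phi:V\to\{1,\dots,|V|\}$ satisfies $e$ if $\phi(e(1))<\phi(e(2))$. With $W$ the total weight and $\rho=1/2$, $I$ is a yes-instance iff some linear ordering satisfies constraints of total weight at least $\rho W+k$; otherwise it is a no-instance. $I$ is irreducible if none of the following rules applies: (Redundancy) some variable of $V$ appears in no constraint, or some constraint has weight $0$; (Merging) two identical constraints occur in $\mathcal{C}$; (Cancellation) there are constraints $e_1,e_2$ with $e_2=(e_1(2),e_1(1))$. -}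

module Defs where

open import Data.Nat using (ℕ; _+_; _*_; _≤_; _<_; NonZero)
open import Data.Fin using (Fin) renaming (_<_ to _<ᶠ_)
open import Data.Fin.Properties using () renaming (_<?_ to _<ᶠ?_)
open import Data.List using (List; []; _∷_; length; lookup)
open import Data.Product using (Σ; _×_; _,_; ∃)
open import Data.Sum using (_⊎_)
open import Relation.Binary.PropositionalEquality using (_≡_; _≢_)
open import Relation.Nullary using (¬_; yes; no)
open import Function.Bundles using (_↔_; Inverse)

-- The variable set V is Fin n (so |V| = n).
-- A binary constraint: ordered pair of distinct variables with a weight w(e) ≥ 0.
record Constraint (n : ℕ) : Set where
  constructor mkC
  field
    fst      : Fin n
    snd      : Fin n
    distinct : fst ≢ snd
    weight   : ℕ
open Constraint public

-- An instance (V, 𝒞, k) with V = Fin n; the multiset 𝒞 is a list.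
record Instance : Set where
  constructor mkI
  field
    n   : ℕ
    cs  : List (Constraint n)
    k   : ℕ
open Instance public

-- A linear ordering φ : V → {1,…,|V|} is a bijection Fin n ↔ Fin n
-- (positions 0,…,n-1 instead of 1,…,n).
LinearOrdering : ℕ → Set
LinearOrdering n = Fin n ↔ Fin n

satisfies : ∀ {n} → LinearOrdering n → Constraint n → Set
satisfies φ e = Inverse.to φ (fst e) <ᶠ Inverse.to φ (snd e)

totalWeight : ∀ {n} → List (Constraint n) → ℕ
totalWeight []       = 0
totalWeight (e ∷ es) = weight e + totalWeight es

satWeight : ∀ {n} → LinearOrdering n → List (Constraint n) → ℕ
satWeight φ [] = 0
satWeight φ (e ∷ es) with Inverse.to φ (fst e) <ᶠ? Inverse.to φ (snd e)
... | yes _ = weight e + satWeight φ es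
... | no  _ = satWeight φ es

-- yes-instance: some ordering satisfies weight ≥ W/2 + k, i.e. 2·sat ≥ W + 2k.
YesInstance : Instance → Set
YesInstance I = Σ (LinearOrdering (n I)) λ φ →
  totalWeight (cs I) + 2 * k I ≤ 2 * satWeight φ (cs I)

NoInstance : Instance → Set
NoInstance I = ¬ YesInstance I

Idx : Instance → Set
Idx I = Fin (length (cs I))

con : (I : Instance) → Idx I → Constraint (n I)
con I i = lookup (cs I) i

RedundancyFree : Instance → Set
RedundancyFree I =
  ((v : Fin (n I)) → ∃ λ (i : Idx I) → fst (con I i) ≡ v ⊎ snd (con I i) ≡ v)
  × ((i : Idx I) → NonZero (weight (con I i)))

MergingFree : Instance → Set
MergingFree I = (i j : Idx I) → i ≢ j →
  ¬ (fst (con I i) ≡ fst (con I j) × snd (con I i) ≡ snd (con I j))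

CancellationFree : Instance → Set
CancellationFree I = (i j : Idx I) →
  ¬ (fst (con I j) ≡ snd (con I i) × snd (con I j) ≡ fst (con I i))

Irreducible : Instance → Set
Irreducible I = RedundancyFree I × MergingFree I × CancellationFree I

module Submission where

-- The surplus of an ordering is its satisfied minus its violated weight,
-- so an ordering satisfies weight (W + surplus)/2 and I is a yes-instance
-- as soon as some linear ordering has surplus ≥ 2k.  We work with weak
-- orderings, keys K : V → ℕ where a tie scores 0, and show that an
-- irreducible instance has one with |V| ≤ 4 · surplus.  Tie-breaking turns
-- it into a linear ordering of no smaller surplus, so |V| ≥ 10k would make
-- I a yes-instance.
--
-- The bound is proved for all subsets S by induction on |S|, in the form
-- |S| ≤ 4 · surplus on S + #(vertices isolated in S).  Take a constraint
-- (a,b) inside S; its block consists of a, b and the leaves, the vertices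
-- whose constraints inside S all go to a or b.  Some ordering of the block
-- has surplus ≥ |block|/4 (block-bound), removing the block does not
-- change which vertices are isolated (isolated-preserved), and orderings
-- of disjoint parts concatenate without loss of surplus (concatenation).

open import Defs
open import Function using (_∘_; case_of_)
open import Function.Bundles using (Inverse)
open import Function.Definitions using (Injective)
open import Data.Bool using (Bool; true; false; _∧_; _∨_; not; if_then_else_)
open import Data.Empty using (⊥; ⊥-elim)
open import Data.Fin using (Fin; zero; suc)
open import Data.Fin.Properties using (_≟_)
open import Data.List using (List; []; _∷_; lookup)
open import Data.Bool.ListAction using (any; all)
open import Data.List.Membership.Propositional using (_∈_)
open import Data.List.Membership.Propositional.Properties using (∈-lookup)
open import Data.List.Relation.Unary.Any using (here; there; index)
open import Data.List.Relation.Unary.Any.Properties using (lookup-index)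
open import Data.Product using (∃; _×_; _,_; proj₁; proj₂)
open import Data.Sum using (_⊎_; inj₁; inj₂)
open import Relation.Binary.PropositionalEquality
open import Relation.Nullary using (¬_; does; yes; no)
open import Relation.Nullary.Decidable using (Dec; dec-true; dec-false)

module Booleans where

  true-or-false : ∀ x → x ≡ true ⊎ x ≡ false
  true-or-false true  = inj₁ refl
  true-or-false false = inj₂ refl

  ∧-split : ∀ x {y} → x ∧ y ≡ true → x ≡ true × y ≡ true
  ∧-split true p = refl , p

  ∨-true : ∀ {x y} → x ∨ y ≡ true → x ≡ true ⊎ y ≡ true
  ∨-true {true}  _ = inj₁ refl
  ∨-true {false} p = inj₂ p

  ∨-intro : ∀ {x y} → x ≡ true ⊎ y ≡ true → x ∨ y ≡ true
  ∨-intro {x} (inj₁ refl) = refl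
  ∨-intro {true}  (inj₂ refl) = refl
  ∨-intro {false} (inj₂ refl) = refl

  does⇒ : ∀ {A : Set} (a? : Dec A) → does a? ≡ true → A
  does⇒ (yes a) _ = a
  does⇒ (no _)  ()

  _=?_ : ∀ {n} → Fin n → Fin n → Bool
  x =? y = does (x ≟ y)

  =?-refl : ∀ {n} (x : Fin n) → x =? x ≡ true
  =?-refl x = dec-true (x ≟ x) refl

  =?-≢ : ∀ {n} {x y : Fin n} → x ≢ y → x =? y ≡ false
  =?-≢ {x = x} {y} = dec-false (x ≟ y)

  =?⇒≡ : ∀ {n} {x y : Fin n} → x =? y ≡ true → x ≡ y
  =?⇒≡ {x = x} {y} = does⇒ (x ≟ y)

  not=?⇒≢ : ∀ {n} {x y : Fin n} → not (x =? y) ≡ true → x ≢ y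
  not=?⇒≢ {x = x} p refl rewrite =?-refl x = case p of λ ()

  any-intro : ∀ {A : Set} {p : A → Bool} {xs e} → e ∈ xs → p e ≡ true → any p xs ≡ true
  any-intro (here refl) q rewrite q = refl
  any-intro {p = p} {x ∷ xs} (there m) q with p x
  ... | true  = refl
  ... | false = any-intro m q

  any-elim : ∀ {A : Set} {p : A → Bool} xs → any p xs ≡ true → ∃ λ e → e ∈ xs × p e ≡ true
  any-elim {p = p} (x ∷ xs) q with p x in px
  ... | true  = x , here refl , px
  ... | false with any-elim xs q
  ...   | e , m , pe = e , there m , pe

  any-false : ∀ {A : Set} {p : A → Bool} {xs e} → any p xs ≡ false → e ∈ xs → p e ≡ false
  any-false {p = p} {x ∷ xs} q (here refl) with p x
  ... | false = refl
  any-false {p = p} {x ∷ xs} q (there m) with p x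
  ... | false = any-false q m

  any-none : ∀ {A : Set} {p : A → Bool} xs → (∀ {e} → e ∈ xs → p e ≡ false) → any p xs ≡ false
  any-none []       h = refl
  any-none (x ∷ xs) h rewrite h (here refl) = any-none xs (h ∘ there)

  all-intro : ∀ {A : Set} {p : A → Bool} xs → (∀ {e} → e ∈ xs → p e ≡ true) → all p xs ≡ true
  all-intro []       h = refl
  all-intro (x ∷ xs) h rewrite h (here refl) = all-intro xs (h ∘ there)

  all-elim : ∀ {A : Set} {p : A → Bool} {xs e} → all p xs ≡ true → e ∈ xs → p e ≡ true
  all-elim {p = p} {x ∷ xs} q (here refl) with p x
  ... | true = refl
  all-elim {p = p} {x ∷ xs} q (there m) with p x
  ... | true = all-elim q m

module Sums where
  open import Data.Nat using (ℕ; zero; suc; _+_; _≤_; _<_; z≤n; s≤s)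
  open import Data.Nat.Properties
  open Booleans
  open import Algebra.Properties.CommutativeMonoid.Sum +-0-commutativeMonoid public
    using (sum-cong-≗; ∑-distrib-+) renaming (sum to ∑)

  ∑-mono-≤ : ∀ {m} {f g : Fin m → ℕ} → (∀ u → f u ≤ g u) → ∑ f ≤ ∑ g
  ∑-mono-≤ {zero}  h = z≤n
  ∑-mono-≤ {suc m} h = +-mono-≤ (h zero) (∑-mono-≤ (h ∘ suc))

  ∑-mono-< : ∀ {m} {f g : Fin m → ℕ} → (∀ u → f u ≤ g u) → (v : Fin m) → f v < g v → ∑ f < ∑ g
  ∑-mono-< h zero    lt = +-mono-<-≤ lt (∑-mono-≤ (h ∘ suc))
  ∑-mono-< h (suc v) lt = +-mono-≤-< (h zero) (∑-mono-< (h ∘ suc) v lt)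

  ∑-zero : ∀ {m} (f : Fin m → ℕ) → (∀ u → f u ≡ 0) → ∑ f ≡ 0
  ∑-zero {zero}  f h = refl
  ∑-zero {suc m} f h rewrite h zero = ∑-zero (f ∘ suc) (h ∘ suc)

  ∑-term : ∀ {m} (f : Fin m → ℕ) (v : Fin m) → f v ≤ ∑ f
  ∑-term f zero    = m≤m+n _ _
  ∑-term f (suc v) = ≤-trans (∑-term (f ∘ suc) v) (m≤n+m _ _)

  ∑-point : ∀ {m} (x : Fin m) (f : Fin m → ℕ) → ∑ (λ u → if u =? x then f u else 0) ≡ f x
  ∑-point {suc m} zero f = trans (cong (f zero +_) (∑-zero {m} _ (λ _ → refl))) (+-identityʳ (f zero))
  ∑-point (suc x) f    = ∑-point x (f ∘ suc)

  ⟦_⟧ : Bool → ℕ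
  ⟦ b ⟧ = if b then 1 else 0

  card : ∀ {m} → (Fin m → Bool) → ℕ
  card S = ∑ (λ v → ⟦ S v ⟧)

  card-full : ∀ m → card {m} (λ _ → true) ≡ m
  card-full zero    = refl
  card-full (suc m) = cong suc (card-full m)

  card-⊂ : ∀ {m} {S T : Fin m → Bool} → (∀ v → S v ≡ true → T v ≡ true) →
           (v : Fin m) → S v ≡ false → T v ≡ true → card S < card T
  card-⊂ {S = S} {T} S⊆T v Sv Tv = ∑-mono-< ⟦S⟧≤⟦T⟧ v (subst₂ (λ s t → ⟦ s ⟧ < ⟦ t ⟧) (sym Sv) (sym Tv) ≤-refl)
    where
    ⟦S⟧≤⟦T⟧ : ∀ u → ⟦ S u ⟧ ≤ ⟦ T u ⟧
    ⟦S⟧≤⟦T⟧ u with S u in Su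
    ... | false = z≤n
    ... | true rewrite S⊆T u Su = ≤-refl

  card-< : ∀ {m} {S : Fin m → Bool} (v : Fin m) → S v ≡ false → card S < m
  card-< {m} {S} v Sv = subst (card S <_) (card-full m) (card-⊂ (λ _ _ → refl) v Sv refl)

  ∑ₗ : ∀ {A : Set} → (A → ℕ) → List A → ℕ
  ∑ₗ f []       = 0
  ∑ₗ f (x ∷ xs) = f x + ∑ₗ f xs

  ∑ₗ-term : ∀ {A : Set} (f : A → ℕ) {xs e} → e ∈ xs → f e ≤ ∑ₗ f xs
  ∑ₗ-term f (here refl)          = m≤m+n _ _
  ∑ₗ-term f {x ∷ xs} (there e∈) = ≤-trans (∑ₗ-term f e∈) (m≤n+m _ (f x))

  ∑ₗ-mono : ∀ {A : Set} {f g : A → ℕ} xs → (∀ {e} → e ∈ xs → f e ≤ g e) → ∑ₗ f xs ≤ ∑ₗ g xs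
  ∑ₗ-mono []       h = z≤n
  ∑ₗ-mono (x ∷ xs) h = +-mono-≤ (h (here refl)) (∑ₗ-mono xs (h ∘ there))

  ∑-∑ₗ-comm : ∀ {A : Set} {m} (h : Fin m → A → ℕ) xs →
              ∑ (λ u → ∑ₗ (h u) xs) ≡ ∑ₗ (λ e → ∑ (λ u → h u e)) xs
  ∑-∑ₗ-comm {m = m} h [] = ∑-zero {m} _ (λ _ → refl)
  ∑-∑ₗ-comm h (x ∷ xs) = trans (∑-distrib-+ (λ u → h u x) (λ u → ∑ₗ (h u) xs))
                                (cong (∑ (λ u → h u x) +_) (∑-∑ₗ-comm h xs))

-- A key K : Fin n → ℕ orders the
-- variables, ties allowed.  A constraint (x,y) of weight w scores +w if
-- K x < K y, -w if K y < K x and 0 on a tie; the surplus of K on a subset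
-- S is the total score of the constraints with both ends in S.
module Surplus where
  open import Data.Nat as ℕ using (ℕ; zero; suc; z≤n; s≤s)
  import Data.Nat.Properties as ℕₚ
  open import Data.Integer using (ℤ; +_; -_; _+_; _≤_)
  import Data.Integer.Properties as ℤₚ
  open import Data.Integer.Tactic.RingSolver using (solve-∀)
  open import Relation.Binary using (tri<; tri≈; tri>)
  open Booleans
  open Sums

  score : ℕ → ℕ → ℕ → ℤ
  score x y w with ℕₚ.<-cmp x y
  ... | tri< _ _ _ = + w
  ... | tri≈ _ _ _ = + 0
  ... | tri> _ _ _ = - (+ w)

  score-< : ∀ {x y} w → x ℕ.< y → score x y w ≡ + w
  score-< {x} {y} w x<y with ℕₚ.<-cmp x y
  ... | tri< _ _ _   = refl
  ... | tri≈ x≮y _ _ = ⊥-elim (x≮y x<y)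
  ... | tri> x≮y _ _ = ⊥-elim (x≮y x<y)

  score-> : ∀ {x y} w → y ℕ.< x → score x y w ≡ - (+ w)
  score-> {x} {y} w y<x with ℕₚ.<-cmp x y
  ... | tri< _ _ y≮x = ⊥-elim (y≮x y<x)
  ... | tri≈ _ _ y≮x = ⊥-elim (y≮x y<x)
  ... | tri> _ _ _   = refl

  score-≡ : ∀ x w → score x x w ≡ + 0
  score-≡ x w with ℕₚ.<-cmp x x
  ... | tri< x<x _ _ = ⊥-elim (ℕₚ.<-irrefl refl x<x)
  ... | tri≈ _ _ _   = refl
  ... | tri> _ _ x<x = ⊥-elim (ℕₚ.<-irrefl refl x<x)

  score-shift : ∀ M x y w → score (M ℕ.+ x) (M ℕ.+ y) w ≡ score x y w
  score-shift M x y w with ℕₚ.<-cmp x y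
  ... | tri< x<y _ _ = score-< w (ℕₚ.+-monoʳ-< M x<y)
  ... | tri≈ _ refl _ = score-≡ (M ℕ.+ x) w
  ... | tri> _ _ y<x = score-> w (ℕₚ.+-monoʳ-< M y<x)

  ∑ℤ : ∀ {A : Set} → (A → ℤ) → List A → ℤ
  ∑ℤ f []       = + 0
  ∑ℤ f (x ∷ xs) = f x + ∑ℤ f xs

  ∑ℤ-+ : ∀ {A : Set} (f g : A → ℤ) xs → ∑ℤ (λ e → f e + g e) xs ≡ ∑ℤ f xs + ∑ℤ g xs
  ∑ℤ-+ f g []       = refl
  ∑ℤ-+ f g (x ∷ xs) rewrite ∑ℤ-+ f g xs = swap (f x) (g x) (∑ℤ f xs) (∑ℤ g xs)
    where
    swap : ∀ a b c d → (a + b) + (c + d) ≡ (a + c) + (b + d)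
    swap = solve-∀

  ∑ℤ-cong : ∀ {A : Set} {f g : A → ℤ} xs → (∀ {e} → e ∈ xs → f e ≡ g e) → ∑ℤ f xs ≡ ∑ℤ g xs
  ∑ℤ-cong []       h = refl
  ∑ℤ-cong (x ∷ xs) h = cong₂ _+_ (h (here refl)) (∑ℤ-cong xs (h ∘ there))

  ∑ℤ-mono : ∀ {A : Set} {f g : A → ℤ} xs → (∀ {e} → e ∈ xs → f e ≤ g e) → ∑ℤ f xs ≤ ∑ℤ g xs
  ∑ℤ-mono []       h = ℤₚ.≤-refl
  ∑ℤ-mono (x ∷ xs) h = ℤₚ.+-mono-≤ (h (here refl)) (∑ℤ-mono xs (h ∘ there))

  ∑ℤ-zero : ∀ {A : Set} (xs : List A) → ∑ℤ (λ _ → + 0) xs ≡ + 0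
  ∑ℤ-zero []       = refl
  ∑ℤ-zero (x ∷ xs) = cong (_+_ (+ 0)) (∑ℤ-zero xs)

  ∑ℤ-ℕ : ∀ {A : Set} (f : A → ℕ) xs → ∑ℤ (λ e → + f e) xs ≡ + ∑ₗ f xs
  ∑ℤ-ℕ f []       = refl
  ∑ℤ-ℕ f (x ∷ xs) = cong (_+_ (+ f x)) (∑ℤ-ℕ f xs)

  average : ∀ a b c → c + c ≤ a + b → c ≤ a ⊎ c ≤ b
  average a b c h with c ℤₚ.≤? a | c ℤₚ.≤? b
  ... | yes c≤a | _       = inj₁ c≤a
  ... | no _    | yes c≤b = inj₂ c≤b
  ... | no c≰a  | no c≰b  =
    ⊥-elim (ℤₚ.<-irrefl refl (ℤₚ.<-≤-trans (ℤₚ.+-mono-< (ℤₚ.≰⇒> c≰a) (ℤₚ.≰⇒> c≰b)) h))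

  larger : ∀ {X : Set} (f : X → ℤ) (x y : X) → ∃ λ z → f x ≤ f z × f y ≤ f z
  larger f x y with ℤₚ.≤-total (f x) (f y)
  ... | inj₁ fx≤fy = y , fx≤fy , ℤₚ.≤-refl
  ... | inj₂ fy≤fx = x , ℤₚ.≤-refl , fy≤fx

  halve : ∀ a b → a + a ≤ b + b → a ≤ b
  halve a b h with average b b a h
  ... | inj₁ a≤b = a≤b
  ... | inj₂ a≤b = a≤b

  whenBoth : Bool → Bool → ℤ → ℤ
  whenBoth p q z = if p ∧ q then z else + 0

  contribution : ∀ {n} → (Fin n → ℕ) → (Fin n → Bool) → Constraint n → ℤ
  contribution K S e = whenBoth (S (fst e)) (S (snd e)) (score (K (fst e)) (K (snd e)) (weight e))

  surplus : ∀ {n} → List (Constraint n) → (Fin n → ℕ) → (Fin n → Bool) → ℤ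
  surplus cs K S = ∑ℤ (contribution K S) cs

  -- One constraint under the two concatenations of disjoint orderings of
  -- B (keys kb) and R (keys kr), all keys below M: placing R after B
  -- (shift R by M) or B after R (shift B by M).  Constraints inside B or
  -- inside R keep their score in both, constraints between B and R score
  -- +w in one and -w in the other.
  concat-edge : ∀ (bx by rx ry : Bool) → (bx ≡ true → rx ≡ false) → (by ≡ true → ry ≡ false) →
    ∀ (kbx kby krx kry M w : ℕ) → kbx ℕ.< M → kby ℕ.< M → krx ℕ.< M → kry ℕ.< M →
    whenBoth (bx ∨ rx) (by ∨ ry) (score (if bx then kbx else M ℕ.+ krx) (if by then kby else M ℕ.+ kry) w)
    + whenBoth (bx ∨ rx) (by ∨ ry) (score (if bx then M ℕ.+ kbx else krx) (if by then M ℕ.+ kby else kry) w)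
    ≡ (whenBoth bx by (score kbx kby w) + whenBoth rx ry (score krx kry w))
      + (whenBoth bx by (score kbx kby w) + whenBoth rx ry (score krx kry w))
  concat-edge true _ true _ bx⇒¬rx _ _ _ _ _ _ _ _ _ _ _ with () ← bx⇒¬rx refl
  concat-edge _ true _ true _ by⇒¬ry _ _ _ _ _ _ _ _ _ _ with () ← by⇒¬ry refl
  concat-edge true true false false _ _ kbx kby krx kry M w _ _ _ _
    rewrite score-shift M kbx kby w = double+0 (score kbx kby w)
    where
    double+0 : ∀ c → c + c ≡ (c + + 0) + (c + + 0)
    double+0 = solve-∀
  concat-edge false false true true _ _ kbx kby krx kry M w _ _ _ _
    rewrite score-shift M krx kry w = double0+ (score krx kry w)
    where
    double0+ : ∀ c → c + c ≡ (+ 0 + c) + (+ 0 + c)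
    double0+ = solve-∀
  concat-edge true false false true _ _ kbx kby krx kry M w kbx<M _ _ kry<M
    rewrite score-< {kbx} {M ℕ.+ kry} w (ℕₚ.<-≤-trans kbx<M (ℕₚ.m≤m+n M kry))
          | score-> {M ℕ.+ kbx} {kry} w (ℕₚ.<-≤-trans kry<M (ℕₚ.m≤m+n M kbx)) = ℤₚ.+-inverseʳ (+ w)
  concat-edge false true true false _ _ kbx kby krx kry M w _ kby<M krx<M _
    rewrite score-> {M ℕ.+ krx} {kby} w (ℕₚ.<-≤-trans kby<M (ℕₚ.m≤m+n M krx))
          | score-< {krx} {M ℕ.+ kby} w (ℕₚ.<-≤-trans krx<M (ℕₚ.m≤m+n M kby)) = ℤₚ.+-inverseˡ (+ w)
  concat-edge true  false false false _ _ _ _ _ _ _ _ _ _ _ _ = refl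
  concat-edge false true  false false _ _ _ _ _ _ _ _ _ _ _ _ = refl
  concat-edge false false true  false _ _ _ _ _ _ _ _ _ _ _ _ = refl
  concat-edge false false false true  _ _ _ _ _ _ _ _ _ _ _ _ = refl
  concat-edge false false false false _ _ _ _ _ _ _ _ _ _ _ _ = refl

  concatenation : ∀ {n} (cs : List (Constraint n)) (B R S : Fin n → Bool) →
                  (∀ v → S v ≡ B v ∨ R v) → (∀ v → B v ≡ true → R v ≡ false) →
                  (KB KR : Fin n → ℕ) → ∃ λ K → surplus cs KB B + surplus cs KR R ≤ surplus cs K S
  concatenation {n} cs B R S S≡B∪R B∩R=∅ KB KR =
    better (average (surplus cs K₁ S) (surplus cs K₂ S) (surplus cs KB B + surplus cs KR R) twice≤)
    where
    M : ℕ
    M = suc (∑ KB ℕ.+ ∑ KR)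
    K₁ K₂ : Fin n → ℕ
    K₁ v = if B v then KB v else M ℕ.+ KR v
    K₂ v = if B v then M ℕ.+ KB v else KR v
    KB<M : ∀ v → KB v ℕ.< M
    KB<M v = s≤s (ℕₚ.≤-trans (∑-term KB v) (ℕₚ.m≤m+n _ _))
    KR<M : ∀ v → KR v ℕ.< M
    KR<M v = s≤s (ℕₚ.≤-trans (∑-term KR v) (ℕₚ.m≤n+m _ _))
    per-edge : ∀ e → contribution K₁ S e + contribution K₂ S e
                     ≡ (contribution KB B e + contribution KR R e) + (contribution KB B e + contribution KR R e)
    per-edge e rewrite S≡B∪R (fst e) | S≡B∪R (snd e) =
      concat-edge (B (fst e)) (B (snd e)) (R (fst e)) (R (snd e)) (B∩R=∅ (fst e)) (B∩R=∅ (snd e))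
                  (KB (fst e)) (KB (snd e)) (KR (fst e)) (KR (snd e)) M (weight e)
                  (KB<M _) (KB<M _) (KR<M _) (KR<M _)
    twice≤ : (surplus cs KB B + surplus cs KR R) + (surplus cs KB B + surplus cs KR R)
             ≤ surplus cs K₁ S + surplus cs K₂ S
    twice≤ = ℤₚ.≤-reflexive (begin
      (surplus cs KB B + surplus cs KR R) + (surplus cs KB B + surplus cs KR R)
        ≡⟨ cong₂ _+_ (∑ℤ-+ _ _ cs) (∑ℤ-+ _ _ cs) ⟨
      ∑ℤ (λ e → contribution KB B e + contribution KR R e) cs
        + ∑ℤ (λ e → contribution KB B e + contribution KR R e) cs
        ≡⟨ ∑ℤ-+ _ _ cs ⟨
      ∑ℤ (λ e → (contribution KB B e + contribution KR R e) + (contribution KB B e + contribution KR R e)) cs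
        ≡⟨ ∑ℤ-cong cs (λ {e} _ → sym (per-edge e)) ⟩
      ∑ℤ (λ e → contribution K₁ S e + contribution K₂ S e) cs
        ≡⟨ ∑ℤ-+ _ _ cs ⟩
      surplus cs K₁ S + surplus cs K₂ S ∎)
      where open ≡-Reasoning
    better : surplus cs KB B + surplus cs KR R ≤ surplus cs K₁ S ⊎ surplus cs KB B + surplus cs KR R ≤ surplus cs K₂ S →
             ∃ λ K → surplus cs KB B + surplus cs KR R ≤ surplus cs K S
    better (inj₁ ≤K₁) = K₁ , ≤K₁
    better (inj₂ ≤K₂) = K₂ , ≤K₂

-- Ties are broken by the
-- index of the variable, once ascending and once descending; the two
-- refinements together score every tied constraint +w and -w, so one of
-- them does at least as well as K.
module TieBreaking where
  open import Data.Nat as ℕ using (ℕ; suc; s≤s; _*_; _+_)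
  import Data.Nat.Properties as ℕₚ
  open import Data.Fin using (toℕ; opposite)
  import Data.Fin.Properties as Finₚ
  open import Data.Integer as ℤ using (ℤ)
  import Data.Integer.Properties as ℤₚ
  open import Relation.Binary using (tri<; tri≈; tri>)
  open Surplus

  lex-< : ∀ {n x y i j} → i ℕ.< n → j ℕ.< n → x ℕ.< y → x * n + i ℕ.< y * n + j
  lex-< {n} {x} {y} {i} {j} i<n j<n x<y = begin-strict
    x * n + i   <⟨ ℕₚ.+-monoʳ-< (x * n) i<n ⟩
    x * n + n   ≡⟨ ℕₚ.+-comm (x * n) n ⟩
    suc x * n   ≤⟨ ℕₚ.*-monoˡ-≤ n x<y ⟩
    y * n       ≤⟨ ℕₚ.m≤m+n (y * n) j ⟩
    y * n + j   ∎
    where open ℕₚ.≤-Reasoning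

  module Refine {n} (K : Fin n → ℕ) (t : Fin n → Fin n) (t-inj : Injective _≡_ _≡_ t) where
    key : Fin n → ℕ
    key v = K v * n + toℕ (t v)

    key-injective : Injective _≡_ _≡_ key
    key-injective {u} {v} eq with ℕₚ.<-cmp (K u) (K v)
    ... | tri< Ku<Kv _ _ = ⊥-elim (ℕₚ.<-irrefl eq (lex-< (Finₚ.toℕ<n (t u)) (Finₚ.toℕ<n (t v)) Ku<Kv))
    ... | tri> _ _ Kv<Ku = ⊥-elim (ℕₚ.<-irrefl (sym eq) (lex-< (Finₚ.toℕ<n (t v)) (Finₚ.toℕ<n (t u)) Kv<Ku))
    ... | tri≈ _ Ku≡Kv _ rewrite Ku≡Kv = t-inj (Finₚ.toℕ-injective (ℕₚ.+-cancelˡ-≡ (K v * n) _ _ eq))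

    key-< : ∀ {u v} → K u ℕ.< K v → key u ℕ.< key v
    key-< = lex-< (Finₚ.toℕ<n _) (Finₚ.toℕ<n _)

    key-tie : ∀ {u v} → K u ≡ K v → toℕ (t u) ℕ.< toℕ (t v) → key u ℕ.< key v
    key-tie {u} {v} Ku≡Kv tu<tv rewrite Ku≡Kv = ℕₚ.+-monoʳ-< (K v * n) tu<tv

  opposite-injective : ∀ {n} → Injective _≡_ _≡_ (opposite {n})
  opposite-injective {_} {u} {v} eq =
    trans (sym (Finₚ.opposite-involutive u)) (trans (cong opposite eq) (Finₚ.opposite-involutive v))

  opposite-< : ∀ {n} {u v : Fin n} → toℕ u ℕ.< toℕ v → toℕ (opposite v) ℕ.< toℕ (opposite u)
  opposite-< {u = u} {v} u<v rewrite Finₚ.opposite-prop u | Finₚ.opposite-prop v =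
    ℕₚ.∸-monoʳ-< (s≤s u<v) (Finₚ.toℕ<n v)

  module _ {n} (K : Fin n → ℕ) where
    open Refine K (λ v → v) (λ eq → eq) renaming (key to K↑; key-< to K↑-<; key-tie to K↑-tie)
    open Refine K opposite opposite-injective renaming (key to K↓; key-< to K↓-<; key-tie to K↓-tie)

    refinements-score : ∀ (e : Constraint n) →
      score (K↑ (fst e)) (K↑ (snd e)) (weight e) ℤ.+ score (K↓ (fst e)) (K↓ (snd e)) (weight e)
      ≡ score (K (fst e)) (K (snd e)) (weight e) ℤ.+ score (K (fst e)) (K (snd e)) (weight e)
    refinements-score e with ℕₚ.<-cmp (K (fst e)) (K (snd e))
    ... | tri< x<y _ _ rewrite score-< (weight e) (K↑-< x<y) | score-< (weight e) (K↓-< x<y) = refl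
    ... | tri> _ _ y<x rewrite score-> (weight e) (K↑-< y<x) | score-> (weight e) (K↓-< y<x) = refl
    ... | tri≈ _ x≡y _ with ℕₚ.<-cmp (toℕ (fst e)) (toℕ (snd e))
    ...   | tri< x<y _ _ rewrite score-< (weight e) (K↑-tie x≡y x<y)
                               | score-> (weight e) (K↓-tie (sym x≡y) (opposite-< x<y))
                               = ℤₚ.+-inverseʳ (ℤ.+ weight e)
    ...   | tri≈ _ x≡y′ _ = ⊥-elim (distinct e (Finₚ.toℕ-injective x≡y′))
    ...   | tri> _ _ y<x rewrite score-> (weight e) (K↑-tie (sym x≡y) y<x)
                               | score-< (weight e) (K↓-tie x≡y (opposite-< y<x))
                               = ℤₚ.+-inverseˡ (ℤ.+ weight e)

    tieBreak : (cs : List (Constraint n)) (S : Fin n → Bool) →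
               ∃ λ K* → Injective _≡_ _≡_ K* × surplus cs K S ℤ.≤ surplus cs K* S
    tieBreak cs S = better (average (surplus cs K↑ S) (surplus cs K↓ S) (surplus cs K S) (ℤₚ.≤-reflexive twice≡))
      where
      per-edge : ∀ e → contribution K↑ S e ℤ.+ contribution K↓ S e ≡ contribution K S e ℤ.+ contribution K S e
      per-edge e with S (fst e) ∧ S (snd e)
      ... | true  = refinements-score e
      ... | false = refl
      twice≡ : surplus cs K S ℤ.+ surplus cs K S ≡ surplus cs K↑ S ℤ.+ surplus cs K↓ S
      twice≡ = trans (sym (∑ℤ-+ _ _ cs)) (trans (∑ℤ-cong cs (λ {e} _ → sym (per-edge e))) (∑ℤ-+ _ _ cs))
      better : surplus cs K S ℤ.≤ surplus cs K↑ S ⊎ surplus cs K S ℤ.≤ surplus cs K↓ S →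
               ∃ λ K* → Injective _≡_ _≡_ K* × surplus cs K S ℤ.≤ surplus cs K* S
      better (inj₁ ≤K↑) = K↑ , Refine.key-injective K (λ v → v) (λ eq → eq) , ≤K↑
      better (inj₂ ≤K↓) = K↓ , Refine.key-injective K opposite opposite-injective , ≤K↓

-- An injective key K determines a linear ordering:
-- each variable is sent to its rank, the number of variables of smaller
-- key.
module StrictOrderings where
  open import Data.Nat as ℕ using (ℕ; zero; suc; _<?_)
  import Data.Nat.Properties as ℕₚ
  open import Data.Fin as Fin using (toℕ; fromℕ<; punchOut)
  import Data.Fin.Properties as Finₚ
  open import Data.Integer as ℤ using (+_; -_)
  open import Data.Integer.Tactic.RingSolver using (solve-∀)
  open import Function.Bundles using (mk↔ₛ′)
  open import Relation.Binary using (tri<; tri≈; tri>)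
  open Booleans
  open Sums
  open Surplus

  injective⇒surjective : ∀ {m} (f : Fin m → Fin m) → Injective _≡_ _≡_ f → ∀ y → ∃ λ x → f x ≡ y
  injective⇒surjective {m} f f-inj y with Finₚ.any? (λ x → f x Finₚ.≟ y)
  ... | yes hit = hit
  injective⇒surjective {suc m} f f-inj y | no miss =
    ⊥-elim (ℕₚ.<-irrefl refl (Finₚ.injective⇒≤ g-inj))
    where
    y≢f : ∀ x → y ≢ f x
    y≢f x y≡fx = miss (x , sym y≡fx)
    g : Fin (suc m) → Fin m
    g x = punchOut (y≢f x)
    g-inj : Injective _≡_ _≡_ g
    g-inj {x} {z} eq = f-inj (Finₚ.punchOut-injective (y≢f x) (y≢f z) eq)

  module Ranking {n} (K : Fin n → ℕ) (K-inj : Injective _≡_ _≡_ K) where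
    below : Fin n → Fin n → Bool
    below v u = does (K u <? K v)

    rank : Fin n → ℕ
    rank v = card (below v)

    below-elim : ∀ {v u} → below v u ≡ true → K u ℕ.< K v
    below-elim {v} {u} = does⇒ (K u <? K v)

    not-below-self : ∀ v → below v v ≡ false
    not-below-self v = dec-false (K v <? K v) (ℕₚ.<-irrefl refl)

    rank-< : ∀ {u v} → K u ℕ.< K v → rank u ℕ.< rank v
    rank-< {u} {v} Ku<Kv = card-⊂ below-u⊆below-v u (not-below-self u) (dec-true (K u <? K v) Ku<Kv)
      where
      below-u⊆below-v : ∀ w → below u w ≡ true → below v w ≡ true
      below-u⊆below-v w Kw<Ku = dec-true (K w <? K v) (ℕₚ.<-trans (below-elim Kw<Ku) Ku<Kv)

    rank-reflects-< : ∀ {u v} → rank u ℕ.< rank v → K u ℕ.< K v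
    rank-reflects-< {u} {v} ru<rv with ℕₚ.<-cmp (K u) (K v)
    ... | tri< Ku<Kv _ _ = Ku<Kv
    ... | tri≈ _ Ku≡Kv _ rewrite K-inj Ku≡Kv = ⊥-elim (ℕₚ.<-irrefl refl ru<rv)
    ... | tri> _ _ Kv<Ku = ⊥-elim (ℕₚ.<-asym ru<rv (rank-< Kv<Ku))

    -- The rank of v is less than n since v is not below itself.
    position : Fin n → Fin n
    position v = fromℕ< (card-< {S = below v} v (not-below-self v))

    toℕ-position : ∀ v → toℕ (position v) ≡ rank v
    toℕ-position v = Finₚ.toℕ-fromℕ< _

    position-injective : Injective _≡_ _≡_ position
    position-injective {u} {v} eq with ℕₚ.<-cmp (K u) (K v)
    ... | tri< Ku<Kv _ _ = ⊥-elim (ℕₚ.<-irrefl same-rank (rank-< Ku<Kv))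
      where
      same-rank : rank u ≡ rank v
      same-rank = trans (sym (toℕ-position u)) (trans (cong toℕ eq) (toℕ-position v))
    ... | tri≈ _ Ku≡Kv _ = K-inj Ku≡Kv
    ... | tri> _ _ Kv<Ku = ⊥-elim (ℕₚ.<-irrefl same-rank (rank-< Kv<Ku))
      where
      same-rank : rank v ≡ rank u
      same-rank = trans (sym (toℕ-position v)) (trans (cong toℕ (sym eq)) (toℕ-position u))

    ordering : LinearOrdering n
    ordering = mk↔ₛ′ position (λ y → proj₁ (onto y)) (λ y → proj₂ (onto y))
                     (λ x → position-injective (proj₂ (onto (position x))))
      where
      onto : ∀ y → ∃ λ x → position x ≡ y
      onto = injective⇒surjective position position-injective

    ordering-reflects : ∀ u v → Inverse.to ordering u Fin.< Inverse.to ordering v → K u ℕ.< K v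
    ordering-reflects u v lt = rank-reflects-< (subst₂ ℕ._<_ (toℕ-position u) (toℕ-position v) lt)

    ordering-preserves : ∀ u v → K u ℕ.< K v → Inverse.to ordering u Fin.< Inverse.to ordering v
    ordering-preserves u v lt = subst₂ ℕ._<_ (sym (toℕ-position u)) (sym (toℕ-position v)) (rank-< lt)

  module Agreement {n} (φ : LinearOrdering n) (K : Fin n → ℕ) (K-inj : Injective _≡_ _≡_ K)
    (reflects : ∀ u v → Inverse.to φ u Fin.< Inverse.to φ v → K u ℕ.< K v)
    (preserves : ∀ u v → K u ℕ.< K v → Inverse.to φ u Fin.< Inverse.to φ v) where

    unsatisfied⇒reversed : ∀ e → ¬ (Inverse.to φ (fst e) Fin.< Inverse.to φ (snd e)) → K (snd e) ℕ.< K (fst e)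
    unsatisfied⇒reversed e unsat with ℕₚ.<-cmp (K (fst e)) (K (snd e))
    ... | tri< Kx<Ky _ _ = ⊥-elim (unsat (preserves _ _ Kx<Ky))
    ... | tri≈ _ Kx≡Ky _ = ⊥-elim (distinct e (K-inj Kx≡Ky))
    ... | tri> _ _ Ky<Kx = Ky<Kx

    twice-satWeight : ∀ es → + totalWeight es ℤ.+ surplus es K (λ _ → true) ≡ + satWeight φ es ℤ.+ + satWeight φ es
    twice-satWeight [] = refl
    twice-satWeight (e ∷ es) with Inverse.to φ (fst e) Finₚ.<? Inverse.to φ (snd e)
    ... | yes sat rewrite score-< (weight e) (reflects _ _ sat) = begin
      (+ weight e ℤ.+ + totalWeight es) ℤ.+ (+ weight e ℤ.+ surplus es K (λ _ → true))
        ≡⟨ regroup (+ weight e) (+ totalWeight es) (surplus es K (λ _ → true)) ⟩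
      (+ weight e ℤ.+ + weight e) ℤ.+ (+ totalWeight es ℤ.+ surplus es K (λ _ → true))
        ≡⟨ cong (ℤ._+_ (+ weight e ℤ.+ + weight e)) (twice-satWeight es) ⟩
      (+ weight e ℤ.+ + weight e) ℤ.+ (+ satWeight φ es ℤ.+ + satWeight φ es)
        ≡⟨ interchange (+ weight e) (+ satWeight φ es) ⟩
      (+ weight e ℤ.+ + satWeight φ es) ℤ.+ (+ weight e ℤ.+ + satWeight φ es) ∎
      where
      open ≡-Reasoning
      regroup : ∀ w W s → (w ℤ.+ W) ℤ.+ (w ℤ.+ s) ≡ (w ℤ.+ w) ℤ.+ (W ℤ.+ s)
      regroup = solve-∀
      interchange : ∀ w t → (w ℤ.+ w) ℤ.+ (t ℤ.+ t) ≡ (w ℤ.+ t) ℤ.+ (w ℤ.+ t)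
      interchange = solve-∀
    ... | no unsat rewrite score-> (weight e) (unsatisfied⇒reversed e unsat) =
      trans (cancel (+ weight e) (+ totalWeight es) (surplus es K (λ _ → true))) (twice-satWeight es)
      where
      cancel : ∀ w W s → (w ℤ.+ W) ℤ.+ (- w ℤ.+ s) ≡ W ℤ.+ s
      cancel = solve-∀

open import Data.Nat as ℕ using (ℕ; zero; suc; z≤n; s≤s)
import Data.Nat.Properties as ℕₚ
open import Data.Integer as ℤ using (ℤ; +_; -_)
import Data.Integer.Properties as ℤₚ
open Booleans
open Sums
open Surplus

-- Throughout, cs is a list of constraints with
-- positive weights and without a pair of opposite constraints (what the
-- argument needs of irreducibility); subsets of the variables are
-- Boolean predicates.
module Blocks {n} (cs : List (Constraint n))
  (no-opposite : ∀ {e₁ e₂} → e₁ ∈ cs → e₂ ∈ cs → fst e₂ ≡ snd e₁ → snd e₂ ≡ fst e₁ → ⊥)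
  (positive : ∀ {e} → e ∈ cs → 1 ℕ.≤ weight e) where

  open import Data.Bool.Properties using (∧-conicalˡ; ∧-conicalʳ; ∧-zeroʳ; ∧-identityʳ; ∨-zeroʳ; not-injective)
  open import Data.Integer.Tactic.RingSolver using (solve-∀)

  inside : (Fin n → Bool) → Constraint n → Bool
  inside S e = S (fst e) ∧ S (snd e)

  touches : Fin n → Constraint n → Bool
  touches v e = (v =? fst e) ∨ (v =? snd e)

  touches⇒endpoint : ∀ {v e} → touches v e ≡ true → v ≡ fst e ⊎ v ≡ snd e
  touches⇒endpoint {v} {e} t with ∨-true {v =? fst e} t
  ... | inj₁ p = inj₁ (=?⇒≡ p)
  ... | inj₂ p = inj₂ (=?⇒≡ p)

  touches-fst : ∀ e → touches (fst e) e ≡ true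
  touches-fst e rewrite =?-refl (fst e) = refl

  touches-snd : ∀ e → touches (snd e) e ≡ true
  touches-snd e rewrite =?-refl (snd e) = ∨-zeroʳ _

  touches-end : ∀ {u e} → u ≡ fst e ⊎ u ≡ snd e → touches u e ≡ true
  touches-end {e = e} (inj₁ refl) = touches-fst e
  touches-end {e = e} (inj₂ refl) = touches-snd e

  isolated : (Fin n → Bool) → Fin n → Bool
  isolated S v = not (any (λ e → inside S e ∧ touches v e) cs)

  not-isolated : ∀ {S v e} → e ∈ cs → inside S e ∧ touches v e ≡ true → isolated S v ≡ false
  not-isolated e∈ p = cong not (any-intro e∈ p)

  not-isolated⇒witness : ∀ {S v} → isolated S v ≡ false → ∃ λ e → e ∈ cs × inside S e ∧ touches v e ≡ true
  not-isolated⇒witness p = any-elim cs (not-injective p)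

  arc : Fin n → Fin n → Bool
  arc x y = any (λ e → (fst e =? x) ∧ (snd e =? y)) cs

  arc-intro : ∀ {e x y} → e ∈ cs → fst e ≡ x → snd e ≡ y → arc x y ≡ true
  arc-intro {e} e∈ refl refl = any-intro e∈ (cong₂ _∧_ (=?-refl (fst e)) (=?-refl (snd e)))

  arc-elim : ∀ {x y} → arc x y ≡ true → ∃ λ e → e ∈ cs × fst e ≡ x × snd e ≡ y
  arc-elim p with any-elim cs p
  ... | e , e∈ , q = e , e∈ , =?⇒≡ (∧-conicalˡ _ _ q) , =?⇒≡ (∧-conicalʳ _ _ q)

  arc-asym : ∀ {x y} → arc x y ≡ true → arc y x ≡ false
  arc-asym {x} {y} p with arc y x in q
  ... | false = refl
  ... | true with arc-elim p | arc-elim q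
  ...   | e , e∈ , ex , ey | e′ , e′∈ , e′y , e′x =
    ⊥-elim (no-opposite e∈ e′∈ (trans e′y (sym ey)) (trans e′x (sym ex)))

  contribution-inside : ∀ (K : Fin n → ℕ) (S : Fin n → Bool) e → S (fst e) ≡ true → S (snd e) ≡ true →
                        contribution K S e ≡ score (K (fst e)) (K (snd e)) (weight e)
  contribution-inside K S e p q rewrite p | q = refl

  contribution-outside : ∀ (K : Fin n → ℕ) (S : Fin n → Bool) e → inside S e ≡ false → contribution K S e ≡ + 0
  contribution-outside K S e p rewrite p = refl

  module Block (S : Fin n → Bool) (e₀ : Constraint n) (e₀∈ : e₀ ∈ cs)
               (Sa : S (fst e₀) ≡ true) (Sb : S (snd e₀) ≡ true) where

    a b : Fin n
    a = fst e₀
    b = snd e₀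

    near : Fin n → Fin n → Bool
    near v x = (x =? v) ∨ ((x =? a) ∨ (x =? b))

    near⇒ : ∀ {v x} → near v x ≡ true → x ≡ v ⊎ x ≡ a ⊎ x ≡ b
    near⇒ {v} {x} p with ∨-true {x =? v} p
    ... | inj₁ x≡v = inj₁ (=?⇒≡ x≡v)
    ... | inj₂ q with ∨-true {x =? a} q
    ...   | inj₁ x≡a = inj₂ (inj₁ (=?⇒≡ x≡a))
    ...   | inj₂ x≡b = inj₂ (inj₂ (=?⇒≡ x≡b))

    near-self : ∀ v → near v v ≡ true
    near-self v rewrite =?-refl v = refl

    near-ab : ∀ {v x} → x ≡ a ⊎ x ≡ b → near v x ≡ true
    near-ab {v} (inj₁ refl) rewrite =?-refl a = ∨-zeroʳ _
    near-ab {v} (inj₂ refl) rewrite =?-refl b = trans (cong ((b =? v) ∨_) (∨-zeroʳ _)) (∨-zeroʳ _)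

    confined : Fin n → Constraint n → Bool
    confined v e = not (inside S e ∧ touches v e) ∨ (near v (fst e) ∧ near v (snd e))

    leaf : Fin n → Bool
    leaf v = S v ∧ (not (v =? a) ∧ (not (v =? b) ∧ (not (isolated S v) ∧ all (confined v) cs)))

    block : Fin n → Bool
    block v = (v =? a) ∨ ((v =? b) ∨ leaf v)

    rest : Fin n → Bool
    rest v = S v ∧ not (block v)

    leaf-parts : ∀ {v} → leaf v ≡ true →
                 S v ≡ true × v ≢ a × v ≢ b × isolated S v ≡ false × all (confined v) cs ≡ true
    leaf-parts {v} p with ∧-split (S v) p
    ... | Sv , p₁ with ∧-split (not (v =? a)) p₁
    ... | v≢a , p₂ with ∧-split (not (v =? b)) p₂
    ... | v≢b , p₃ with ∧-split (not (isolated S v)) p₃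
    ... | ¬iso , conf = Sv , not=?⇒≢ v≢a , not=?⇒≢ v≢b , not-injective ¬iso , conf

    leaf⇒S : ∀ {v} → leaf v ≡ true → S v ≡ true
    leaf⇒S = proj₁ ∘ leaf-parts

    leaf⇒≢a : ∀ {v} → leaf v ≡ true → v ≢ a
    leaf⇒≢a = proj₁ ∘ proj₂ ∘ leaf-parts

    leaf⇒≢b : ∀ {v} → leaf v ≡ true → v ≢ b
    leaf⇒≢b = proj₁ ∘ proj₂ ∘ proj₂ ∘ leaf-parts

    leaf⇒not-isolated : ∀ {v} → leaf v ≡ true → isolated S v ≡ false
    leaf⇒not-isolated = proj₁ ∘ proj₂ ∘ proj₂ ∘ proj₂ ∘ leaf-parts

    leaf⇒confined : ∀ {v e} → leaf v ≡ true → e ∈ cs → confined v e ≡ true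
    leaf⇒confined p = all-elim (proj₂ (proj₂ (proj₂ (proj₂ (leaf-parts p)))))

    leaf-intro : ∀ {v} → S v ≡ true → v ≢ a → v ≢ b → isolated S v ≡ false →
                 (∀ {e} → e ∈ cs → confined v e ≡ true) → leaf v ≡ true
    leaf-intro {v} Sv v≢a v≢b ¬iso conf rewrite Sv | =?-≢ v≢a | =?-≢ v≢b | ¬iso = all-intro cs conf

    leaf-false : ∀ {v} → v ≡ a ⊎ v ≡ b → leaf v ≡ false
    leaf-false {v} v∈ab with leaf v in p
    ... | false = refl
    ... | true with v∈ab
    ...   | inj₁ v≡a = ⊥-elim (leaf⇒≢a p v≡a)
    ...   | inj₂ v≡b = ⊥-elim (leaf⇒≢b p v≡b)

    confined⇒near : ∀ {v e} → confined v e ≡ true → inside S e ∧ touches v e ≡ true →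
                    near v (fst e) ∧ near v (snd e) ≡ true
    confined⇒near p q rewrite q = p

    leaf-neighbour : ∀ {e u} → e ∈ cs → leaf u ≡ true → inside S e ≡ true → u ≡ fst e ⊎ u ≡ snd e →
                     (fst e ≡ a ⊎ fst e ≡ b) ⊎ (snd e ≡ a ⊎ snd e ≡ b)
    leaf-neighbour {e} {u} e∈ u-leaf e-in u-end =
      other (near⇒ (proj₁ both)) (near⇒ (proj₂ both))
      where
      ends-near : near u (fst e) ∧ near u (snd e) ≡ true
      ends-near = confined⇒near {u} {e} (leaf⇒confined u-leaf e∈) (cong₂ _∧_ e-in (touches-end {u} {e} u-end))
      both : near u (fst e) ≡ true × near u (snd e) ≡ true
      both = ∧-split (near u (fst e)) ends-near
      other : fst e ≡ u ⊎ fst e ≡ a ⊎ fst e ≡ b → snd e ≡ u ⊎ snd e ≡ a ⊎ snd e ≡ b →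
              (fst e ≡ a ⊎ fst e ≡ b) ⊎ (snd e ≡ a ⊎ snd e ≡ b)
      other (inj₂ x∈ab) _           = inj₁ x∈ab
      other (inj₁ _)    (inj₂ y∈ab) = inj₂ y∈ab
      other (inj₁ x≡u)  (inj₁ y≡u)  = ⊥-elim (distinct e (trans x≡u (sym y≡u)))

    block-leaf : ∀ {v} → leaf v ≡ true → block v ≡ true
    block-leaf {v} p rewrite p = trans (cong ((v =? a) ∨_) (∨-zeroʳ _)) (∨-zeroʳ _)

    block-ab : ∀ {v} → v ≡ a ⊎ v ≡ b → block v ≡ true
    block-ab (inj₁ refl) rewrite =?-refl a = refl
    block-ab (inj₂ refl) rewrite =?-refl b = ∨-zeroʳ _

    block-cases : ∀ {v} → block v ≡ true → v ≡ a ⊎ v ≡ b ⊎ leaf v ≡ true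
    block-cases {v} p with ∨-true {v =? a} p
    ... | inj₁ v≡a = inj₁ (=?⇒≡ v≡a)
    ... | inj₂ q with ∨-true {v =? b} q
    ...   | inj₁ v≡b = inj₂ (inj₁ (=?⇒≡ v≡b))
    ...   | inj₂ v-leaf = inj₂ (inj₂ v-leaf)

    block⇒S : ∀ {v} → block v ≡ true → S v ≡ true
    block⇒S {v} p with block-cases {v} p
    ... | inj₁ refl        = Sa
    ... | inj₂ (inj₁ refl) = Sb
    ... | inj₂ (inj₂ v-leaf) = leaf⇒S v-leaf

    -- The four orderings of the block.  a and b sit at 1 and 3 (a before b)
    -- or at 3 and 1 (b before a); a leaf sits at 0 (first), 2 (between a
    -- and b) or 4 (last), chosen from its arcs, or at the parameter z,
    -- which is 0 or 4.  A leaf v is cyclic if a → b → v → a is a cycle.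
    cyclic : Fin n → Bool
    cyclic v = arc v a ∧ arc b v

    slotAB : Fin n → ℕ
    slotAB v = if arc b v then 4 else if arc a v then 2 else 0

    slotBA : Fin n → ℕ
    slotBA v = if arc a v then 4 else if arc b v then 2 else 0

    keyAB : ℕ → Fin n → ℕ
    keyAB z v = if v =? a then 1 else if v =? b then 3 else if cyclic v then z else slotAB v

    keyBA : ℕ → Fin n → ℕ
    keyBA z v = if v =? a then 3 else if v =? b then 1 else if cyclic v then slotBA v else z

    b≢a : b ≢ a
    b≢a b≡a = distinct e₀ (sym b≡a)

    keyAB-a : ∀ {x} z → x ≡ a → keyAB z x ≡ 1
    keyAB-a z refl rewrite =?-refl a = refl

    keyAB-b : ∀ {x} z → x ≡ b → keyAB z x ≡ 3
    keyAB-b z refl rewrite =?-≢ b≢a | =?-refl b = refl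

    keyBA-a : ∀ {x} z → x ≡ a → keyBA z x ≡ 3
    keyBA-a z refl rewrite =?-refl a = refl

    keyBA-b : ∀ {x} z → x ≡ b → keyBA z x ≡ 1
    keyBA-b z refl rewrite =?-≢ b≢a | =?-refl b = refl

    keyAB-leaf : ∀ z {v} → leaf v ≡ true → keyAB z v ≡ (if cyclic v then z else slotAB v)
    keyAB-leaf z p rewrite =?-≢ (leaf⇒≢a p) | =?-≢ (leaf⇒≢b p) = refl

    keyBA-leaf : ∀ z {v} → leaf v ≡ true → keyBA z v ≡ (if cyclic v then slotBA v else z)
    keyBA-leaf z p rewrite =?-≢ (leaf⇒≢a p) | =?-≢ (leaf⇒≢b p) = refl

    acyclic-from-a : ∀ {v} → arc a v ≡ true → cyclic v ≡ false
    acyclic-from-a a→v rewrite arc-asym a→v = refl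

    acyclic-not-from-b : ∀ {v} → arc b v ≡ false → cyclic v ≡ false
    acyclic-not-from-b b↛v rewrite b↛v = ∧-zeroʳ _

    abWeight : Constraint n → ℕ
    abWeight e = if (fst e =? a) ∧ (snd e =? b) then weight e else 0

    leafWeight : Constraint n → ℕ
    leafWeight e = if inside S e ∧ (leaf (fst e) ∨ leaf (snd e)) then weight e else 0

    blockScore : (Fin n → ℕ) → Constraint n → ℤ
    blockScore K e = contribution K block e

    EdgeBound : Constraint n → Set
    EdgeBound e =
      (+ abWeight e ℤ.+ + abWeight e ℤ.≤ blockScore (keyAB 0) e ℤ.+ blockScore (keyAB 4) e) ×
      (+ leafWeight e ℤ.+ + leafWeight e ℤ.≤
         (blockScore (keyAB 0) e ℤ.+ blockScore (keyAB 4) e) ℤ.+ (blockScore (keyBA 0) e ℤ.+ blockScore (keyBA 4) e))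

    blockScore-inside : ∀ K e → block (fst e) ≡ true → block (snd e) ≡ true →
                        ∀ {p q} → K (fst e) ≡ p → K (snd e) ≡ q → blockScore K e ≡ score p q (weight e)
    blockScore-inside K e x∈B y∈B Kx Ky =
      trans (contribution-inside K block e x∈B y∈B) (cong₂ (λ p q → score p q (weight e)) Kx Ky)

    leaf-edge-weights : ∀ {e} → block (fst e) ≡ true → block (snd e) ≡ true →
                        leaf (fst e) ≡ true ⊎ leaf (snd e) ≡ true →
                        abWeight e ≡ 0 × leafWeight e ≡ weight e
    leaf-edge-weights {e} x∈B y∈B leaf-end = no-ab leaf-end , is-leaf
      where
      no-ab : leaf (fst e) ≡ true ⊎ leaf (snd e) ≡ true → abWeight e ≡ 0
      no-ab (inj₁ x-leaf) rewrite =?-≢ (leaf⇒≢a x-leaf) = refl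
      no-ab (inj₂ y-leaf) rewrite =?-≢ (leaf⇒≢b y-leaf) | ∧-zeroʳ (fst e =? a) = refl
      is-leaf : leafWeight e ≡ weight e
      is-leaf = cong (λ c → if c then weight e else 0)
                     (cong₂ _∧_ (cong₂ _∧_ (block⇒S x∈B) (block⇒S y∈B)) (∨-intro leaf-end))

    bound-from : ∀ {e} {A L : ℕ} {t₁ t₂ t₃ t₄ : ℤ} → abWeight e ≡ A → leafWeight e ≡ L →
      blockScore (keyAB 0) e ≡ t₁ → blockScore (keyAB 4) e ≡ t₂ →
      blockScore (keyBA 0) e ≡ t₃ → blockScore (keyBA 4) e ≡ t₄ →
      (+ A ℤ.+ + A ℤ.≤ t₁ ℤ.+ t₂) × (+ L ℤ.+ + L ℤ.≤ (t₁ ℤ.+ t₂) ℤ.+ (t₃ ℤ.+ t₄)) → EdgeBound e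
    bound-from p q r₁ r₂ r₃ r₄ h rewrite p | q | r₁ | r₂ | r₃ | r₄ = h

    leaf-edge-AB : ∀ {e} {t₃ t₄ : ℤ} → block (fst e) ≡ true → block (snd e) ≡ true →
      leaf (fst e) ≡ true ⊎ leaf (snd e) ≡ true →
      blockScore (keyAB 0) e ≡ + weight e → blockScore (keyAB 4) e ≡ + weight e →
      blockScore (keyBA 0) e ≡ t₃ → blockScore (keyBA 4) e ≡ t₄ → t₃ ℤ.+ t₄ ≡ + 0 → EdgeBound e
    leaf-edge-AB {e} x∈B y∈B leaf-end r₁ r₂ r₃ r₄ cancel =
      bound-from {e} (proj₁ weights) (proj₂ weights) r₁ r₂ r₃ r₄
        (ℤ.+≤+ z≤n , ℤₚ.≤-reflexive (sym (trans (cong (ℤ._+_ twice-w) cancel) (ℤₚ.+-identityʳ twice-w))))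
      where
      weights : abWeight e ≡ 0 × leafWeight e ≡ weight e
      weights = leaf-edge-weights {e} x∈B y∈B leaf-end
      twice-w : ℤ
      twice-w = + weight e ℤ.+ + weight e

    leaf-edge-BA : ∀ {e} {t₁ t₂ : ℤ} → block (fst e) ≡ true → block (snd e) ≡ true →
      leaf (fst e) ≡ true ⊎ leaf (snd e) ≡ true →
      blockScore (keyAB 0) e ≡ t₁ → blockScore (keyAB 4) e ≡ t₂ → t₁ ℤ.+ t₂ ≡ + 0 →
      blockScore (keyBA 0) e ≡ + weight e → blockScore (keyBA 4) e ≡ + weight e → EdgeBound e
    leaf-edge-BA {e} x∈B y∈B leaf-end r₁ r₂ cancel r₃ r₄ =
      bound-from {e} (proj₁ weights) (proj₂ weights) r₁ r₂ r₃ r₄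
        (ℤₚ.≤-reflexive (sym cancel) , ℤₚ.≤-reflexive (cong (λ t → t ℤ.+ twice-w) (sym cancel)))
      where
      weights : abWeight e ≡ 0 × leafWeight e ≡ weight e
      weights = leaf-edge-weights {e} x∈B y∈B leaf-end
      twice-w : ℤ
      twice-w = + weight e ℤ.+ + weight e

    bound-ab : ∀ {e} → fst e ≡ a → snd e ≡ b → EdgeBound e
    bound-ab {e} x≡a y≡b =
      bound-from {e} ab-weight leaf-weight (scoreAB 0) (scoreAB 4) (scoreBA 0) (scoreBA 4)
        (ℤₚ.≤-refl , ℤₚ.≤-reflexive (sym (twice-cancel (+ weight e))))
      where
      x∈B : block (fst e) ≡ true
      x∈B = block-ab (inj₁ x≡a)
      y∈B : block (snd e) ≡ true
      y∈B = block-ab (inj₂ y≡b)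
      ab-weight : abWeight e ≡ weight e
      ab-weight rewrite x≡a | y≡b | =?-refl a | =?-refl b = refl
      leaf-weight : leafWeight e ≡ 0
      leaf-weight rewrite leaf-false (inj₁ x≡a) | leaf-false (inj₂ y≡b) =
        cong (λ c → if c then weight e else 0) (∧-zeroʳ (inside S e))
      scoreAB : ∀ z → blockScore (keyAB z) e ≡ score 1 3 (weight e)
      scoreAB z = blockScore-inside (keyAB z) e x∈B y∈B (keyAB-a z x≡a) (keyAB-b z y≡b)
      scoreBA : ∀ z → blockScore (keyBA z) e ≡ score 3 1 (weight e)
      scoreBA z = blockScore-inside (keyBA z) e x∈B y∈B (keyBA-a z x≡a) (keyBA-b z y≡b)
      twice-cancel : ∀ w → (w ℤ.+ w) ℤ.+ (ℤ.- w ℤ.+ ℤ.- w) ≡ + 0 ℤ.+ + 0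
      twice-cancel = solve-∀

    -- A constraint (a, v) with v a leaf: v goes after a when a is first.
    bound-from-a : ∀ {e} → e ∈ cs → fst e ≡ a → leaf (snd e) ≡ true → EdgeBound e
    bound-from-a {e} e∈ x≡a y-leaf =
      leaf-edge-AB {e} x∈B y∈B (inj₂ y-leaf) (scoreAB 0) (scoreAB 4) (scoreBA 0) (scoreBA 4)
                   (ℤₚ.+-inverseˡ (+ weight e))
      where
      x∈B : block (fst e) ≡ true
      x∈B = block-ab (inj₁ x≡a)
      y∈B : block (snd e) ≡ true
      y∈B = block-leaf y-leaf
      a→y : arc a (snd e) ≡ true
      a→y = arc-intro e∈ x≡a refl
      slot : ℕ
      slot = if arc b (snd e) then 4 else 2
      1<slot : 1 ℕ.< slot
      1<slot with arc b (snd e)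
      ... | true  = s≤s (s≤s z≤n)
      ... | false = s≤s (s≤s z≤n)
      keyAB-y : ∀ z → keyAB z (snd e) ≡ slot
      keyAB-y z rewrite keyAB-leaf z y-leaf | acyclic-from-a a→y | a→y = refl
      keyBA-y : ∀ z → keyBA z (snd e) ≡ z
      keyBA-y z rewrite keyBA-leaf z y-leaf | acyclic-from-a a→y = refl
      scoreAB : ∀ z → blockScore (keyAB z) e ≡ + weight e
      scoreAB z = trans (blockScore-inside (keyAB z) e x∈B y∈B (keyAB-a z x≡a) (keyAB-y z))
                        (score-< (weight e) 1<slot)
      scoreBA : ∀ z → blockScore (keyBA z) e ≡ score 3 z (weight e)
      scoreBA z = blockScore-inside (keyBA z) e x∈B y∈B (keyBA-a z x≡a) (keyBA-y z)

    -- A constraint (b, v) with v a leaf.  If v is cyclic it goes between b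
    -- and a when b is first; otherwise after b when a is first.
    bound-from-b-cyclic : ∀ {e} → e ∈ cs → fst e ≡ b → leaf (snd e) ≡ true → arc (snd e) a ≡ true → EdgeBound e
    bound-from-b-cyclic {e} e∈ x≡b y-leaf y→a = leaf-edge-BA {e} x∈B y∈B (inj₂ y-leaf) (scoreAB 0) (scoreAB 4) (ℤₚ.+-inverseˡ (+ weight e))
                              (scoreBA 0) (scoreBA 4)
      where
      x∈B : block (fst e) ≡ true
      x∈B = block-ab (inj₂ x≡b)
      y∈B : block (snd e) ≡ true
      y∈B = block-leaf y-leaf
      b→y : arc b (snd e) ≡ true
      b→y = arc-intro e∈ x≡b refl
      keyAB-y : ∀ z → keyAB z (snd e) ≡ z
      keyAB-y z rewrite keyAB-leaf z y-leaf | y→a | b→y = refl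
      keyBA-y : ∀ z → keyBA z (snd e) ≡ 2
      keyBA-y z rewrite keyBA-leaf z y-leaf | y→a | b→y | arc-asym y→a = refl
      scoreAB : ∀ z → blockScore (keyAB z) e ≡ score 3 z (weight e)
      scoreAB z = blockScore-inside (keyAB z) e x∈B y∈B (keyAB-b z x≡b) (keyAB-y z)
      scoreBA : ∀ z → blockScore (keyBA z) e ≡ score 1 2 (weight e)
      scoreBA z = blockScore-inside (keyBA z) e x∈B y∈B (keyBA-b z x≡b) (keyBA-y z)
    bound-from-b-acyclic : ∀ {e} → e ∈ cs → fst e ≡ b → leaf (snd e) ≡ true → arc (snd e) a ≡ false → EdgeBound e
    bound-from-b-acyclic {e} e∈ x≡b y-leaf y↛a =
      leaf-edge-AB {e} x∈B y∈B (inj₂ y-leaf) (scoreAB 0) (scoreAB 4) (scoreBA 0) (scoreBA 4)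
                   (ℤₚ.+-inverseˡ (+ weight e))
      where
      x∈B : block (fst e) ≡ true
      x∈B = block-ab (inj₂ x≡b)
      y∈B : block (snd e) ≡ true
      y∈B = block-leaf y-leaf
      b→y : arc b (snd e) ≡ true
      b→y = arc-intro e∈ x≡b refl
      keyAB-y : ∀ z → keyAB z (snd e) ≡ 4
      keyAB-y z rewrite keyAB-leaf z y-leaf | y↛a | b→y = refl
      keyBA-y : ∀ z → keyBA z (snd e) ≡ z
      keyBA-y z rewrite keyBA-leaf z y-leaf | y↛a = refl
      scoreAB : ∀ z → blockScore (keyAB z) e ≡ score 3 4 (weight e)
      scoreAB z = blockScore-inside (keyAB z) e x∈B y∈B (keyAB-b z x≡b) (keyAB-y z)
      scoreBA : ∀ z → blockScore (keyBA z) e ≡ score 1 z (weight e)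
      scoreBA z = blockScore-inside (keyBA z) e x∈B y∈B (keyBA-b z x≡b) (keyBA-y z)

    -- A constraint (v, a) with v a leaf.  If v is cyclic it goes between b
    -- and a when b is first; otherwise before a when a is first.
    bound-to-a-cyclic : ∀ {e} → e ∈ cs → leaf (fst e) ≡ true → snd e ≡ a → arc b (fst e) ≡ true → EdgeBound e
    bound-to-a-cyclic {e} e∈ x-leaf y≡a b→x = leaf-edge-BA {e} x∈B y∈B (inj₁ x-leaf) (scoreAB 0) (scoreAB 4) (ℤₚ.+-inverseʳ (+ weight e))
                              (scoreBA 0) (scoreBA 4)
      where
      x∈B : block (fst e) ≡ true
      x∈B = block-leaf x-leaf
      y∈B : block (snd e) ≡ true
      y∈B = block-ab (inj₁ y≡a)
      x→a : arc (fst e) a ≡ true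
      x→a = arc-intro e∈ refl y≡a
      keyAB-x : ∀ z → keyAB z (fst e) ≡ z
      keyAB-x z rewrite keyAB-leaf z x-leaf | x→a | b→x = refl
      keyBA-x : ∀ z → keyBA z (fst e) ≡ 2
      keyBA-x z rewrite keyBA-leaf z x-leaf | x→a | b→x | arc-asym x→a = refl
      scoreAB : ∀ z → blockScore (keyAB z) e ≡ score z 1 (weight e)
      scoreAB z = blockScore-inside (keyAB z) e x∈B y∈B (keyAB-x z) (keyAB-a z y≡a)
      scoreBA : ∀ z → blockScore (keyBA z) e ≡ score 2 3 (weight e)
      scoreBA z = blockScore-inside (keyBA z) e x∈B y∈B (keyBA-x z) (keyBA-a z y≡a)
    bound-to-a-acyclic : ∀ {e} → e ∈ cs → leaf (fst e) ≡ true → snd e ≡ a → arc b (fst e) ≡ false → EdgeBound e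
    bound-to-a-acyclic {e} e∈ x-leaf y≡a b↛x =
      leaf-edge-AB {e} x∈B y∈B (inj₁ x-leaf) (scoreAB 0) (scoreAB 4) (scoreBA 0) (scoreBA 4)
                   (ℤₚ.+-inverseʳ (+ weight e))
      where
      x∈B : block (fst e) ≡ true
      x∈B = block-leaf x-leaf
      y∈B : block (snd e) ≡ true
      y∈B = block-ab (inj₁ y≡a)
      x→a : arc (fst e) a ≡ true
      x→a = arc-intro e∈ refl y≡a
      keyAB-x : ∀ z → keyAB z (fst e) ≡ 0
      keyAB-x z rewrite keyAB-leaf z x-leaf | acyclic-not-from-b b↛x | b↛x | arc-asym x→a = refl
      keyBA-x : ∀ z → keyBA z (fst e) ≡ z
      keyBA-x z rewrite keyBA-leaf z x-leaf | acyclic-not-from-b b↛x = refl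
      scoreAB : ∀ z → blockScore (keyAB z) e ≡ score 0 1 (weight e)
      scoreAB z = blockScore-inside (keyAB z) e x∈B y∈B (keyAB-x z) (keyAB-a z y≡a)
      scoreBA : ∀ z → blockScore (keyBA z) e ≡ score z 3 (weight e)
      scoreBA z = blockScore-inside (keyBA z) e x∈B y∈B (keyBA-x z) (keyBA-a z y≡a)

    bound-from-b : ∀ {e} → e ∈ cs → fst e ≡ b → leaf (snd e) ≡ true → EdgeBound e
    bound-from-b {e} e∈ x≡b y-leaf with true-or-false (arc (snd e) a)
    ... | inj₁ y→a = bound-from-b-cyclic e∈ x≡b y-leaf y→a
    ... | inj₂ y↛a = bound-from-b-acyclic e∈ x≡b y-leaf y↛a

    bound-to-a : ∀ {e} → e ∈ cs → leaf (fst e) ≡ true → snd e ≡ a → EdgeBound e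
    bound-to-a {e} e∈ x-leaf y≡a with true-or-false (arc b (fst e))
    ... | inj₁ b→x = bound-to-a-cyclic e∈ x-leaf y≡a b→x
    ... | inj₂ b↛x = bound-to-a-acyclic e∈ x-leaf y≡a b↛x

    -- A constraint (v, b) with v a leaf: v goes before b when a is first.
    bound-to-b : ∀ {e} → e ∈ cs → leaf (fst e) ≡ true → snd e ≡ b → EdgeBound e
    bound-to-b {e} e∈ x-leaf y≡b =
      leaf-edge-AB {e} x∈B y∈B (inj₁ x-leaf) (scoreAB 0) (scoreAB 4) (scoreBA 0) (scoreBA 4)
                   (ℤₚ.+-inverseʳ (+ weight e))
      where
      x∈B : block (fst e) ≡ true
      x∈B = block-leaf x-leaf
      y∈B : block (snd e) ≡ true
      y∈B = block-ab (inj₂ y≡b)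
      b↛x : arc b (fst e) ≡ false
      b↛x = arc-asym (arc-intro e∈ refl y≡b)
      slot : ℕ
      slot = if arc a (fst e) then 2 else 0
      slot<3 : slot ℕ.< 3
      slot<3 with arc a (fst e)
      ... | true  = s≤s (s≤s (s≤s z≤n))
      ... | false = s≤s z≤n
      keyAB-x : ∀ z → keyAB z (fst e) ≡ slot
      keyAB-x z rewrite keyAB-leaf z x-leaf | acyclic-not-from-b b↛x | b↛x = refl
      keyBA-x : ∀ z → keyBA z (fst e) ≡ z
      keyBA-x z rewrite keyBA-leaf z x-leaf | acyclic-not-from-b b↛x = refl
      scoreAB : ∀ z → blockScore (keyAB z) e ≡ + weight e
      scoreAB z = trans (blockScore-inside (keyAB z) e x∈B y∈B (keyAB-x z) (keyAB-b z y≡b))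
                        (score-< (weight e) slot<3)
      scoreBA : ∀ z → blockScore (keyBA z) e ≡ score z 1 (weight e)
      scoreBA z = blockScore-inside (keyBA z) e x∈B y∈B (keyBA-x z) (keyBA-b z y≡b)

    leaf∉ab : ∀ {v} → leaf v ≡ true → v ≡ a ⊎ v ≡ b → ⊥
    leaf∉ab v-leaf (inj₁ v≡a) = leaf⇒≢a v-leaf v≡a
    leaf∉ab v-leaf (inj₂ v≡b) = leaf⇒≢b v-leaf v≡b

    leaves-not-adjacent : ∀ {e} → e ∈ cs → leaf (fst e) ≡ true → leaf (snd e) ≡ true → ⊥
    leaves-not-adjacent e∈ x-leaf y-leaf
      with leaf-neighbour e∈ x-leaf (cong₂ _∧_ (leaf⇒S x-leaf) (leaf⇒S y-leaf)) (inj₁ refl)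
    ... | inj₁ x∈ab = leaf∉ab x-leaf x∈ab
    ... | inj₂ y∈ab = leaf∉ab y-leaf y∈ab

    leaf-edge-in-block : ∀ {e} → e ∈ cs → inside S e ≡ true → leaf (fst e) ≡ true ⊎ leaf (snd e) ≡ true →
                         block (fst e) ≡ true × block (snd e) ≡ true
    leaf-edge-in-block e∈ e-in (inj₁ x-leaf) with leaf-neighbour e∈ x-leaf e-in (inj₁ refl)
    ... | inj₁ x∈ab = ⊥-elim (leaf∉ab x-leaf x∈ab)
    ... | inj₂ y∈ab = block-leaf x-leaf , block-ab y∈ab
    leaf-edge-in-block e∈ e-in (inj₂ y-leaf) with leaf-neighbour e∈ y-leaf e-in (inj₂ refl)
    ... | inj₁ x∈ab = block-ab x∈ab , block-leaf y-leaf
    ... | inj₂ y∈ab = ⊥-elim (leaf∉ab y-leaf y∈ab)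

    bound-outside : ∀ {e} → e ∈ cs → block (fst e) ≡ false ⊎ block (snd e) ≡ false → EdgeBound e
    bound-outside {e} e∈ outside =
      bound-from {e} ab-weight leaf-weight (no-score (keyAB 0)) (no-score (keyAB 4)) (no-score (keyBA 0)) (no-score (keyBA 4))
                 (ℤₚ.≤-refl , ℤₚ.≤-refl)
      where
      not-both′ : block (fst e) ≡ false ⊎ block (snd e) ≡ false → block (fst e) ≡ true → block (snd e) ≡ true → ⊥
      not-both′ (inj₁ x∉B) x∈B _   = case trans (sym x∈B) x∉B of λ ()
      not-both′ (inj₂ y∉B) _   y∈B = case trans (sym y∈B) y∉B of λ ()
      not-both : block (fst e) ≡ true → block (snd e) ≡ true → ⊥
      not-both = not-both′ outside
      no-score : ∀ K → blockScore K e ≡ + 0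
      no-score K with true-or-false (block (fst e)) | true-or-false (block (snd e))
      ... | inj₂ x∉B | _        = contribution-outside K block e (cong (_∧ block (snd e)) x∉B)
      ... | inj₁ _   | inj₂ y∉B = contribution-outside K block e (trans (cong (block (fst e) ∧_) y∉B) (∧-zeroʳ _))
      ... | inj₁ x∈B | inj₁ y∈B = ⊥-elim (not-both x∈B y∈B)
      ab-weight : abWeight e ≡ 0
      ab-weight with true-or-false ((fst e =? a) ∧ (snd e =? b))
      ... | inj₂ not-ab = cong (λ c → if c then weight e else 0) not-ab
      ... | inj₁ is-ab with ∧-split (fst e =? a) is-ab
      ...   | x≡a , y≡b = ⊥-elim (not-both (block-ab (inj₁ (=?⇒≡ {x = fst e} x≡a))) (block-ab (inj₂ (=?⇒≡ {x = snd e} y≡b))))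
      leaf-weight : leafWeight e ≡ 0
      leaf-weight with true-or-false (inside S e ∧ (leaf (fst e) ∨ leaf (snd e)))
      ... | inj₂ no-leaf = cong (λ c → if c then weight e else 0) no-leaf
      ... | inj₁ at-leaf with ∧-split (inside S e) at-leaf
      ...   | e-in , leaf-end with leaf-edge-in-block e∈ e-in (∨-true leaf-end)
      ...     | x∈B , y∈B = ⊥-elim (not-both x∈B y∈B)

    edge-bound : ∀ {e} → e ∈ cs → EdgeBound e
    edge-bound {e} e∈ with true-or-false (block (fst e)) | true-or-false (block (snd e))
    ... | inj₂ x∉B | _        = bound-outside e∈ (inj₁ x∉B)
    ... | inj₁ _   | inj₂ y∉B = bound-outside e∈ (inj₂ y∉B)
    ... | inj₁ x∈B | inj₁ y∈B with block-cases x∈B | block-cases y∈B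
    ... | inj₁ x≡a          | inj₁ y≡a          = ⊥-elim (distinct e (trans x≡a (sym y≡a)))
    ... | inj₁ x≡a          | inj₂ (inj₁ y≡b)   = bound-ab {e} x≡a y≡b
    ... | inj₁ x≡a          | inj₂ (inj₂ y-leaf) = bound-from-a e∈ x≡a y-leaf
    ... | inj₂ (inj₁ x≡b)   | inj₁ y≡a          = ⊥-elim (no-opposite e₀∈ e∈ x≡b y≡a)
    ... | inj₂ (inj₁ x≡b)   | inj₂ (inj₁ y≡b)   = ⊥-elim (distinct e (trans x≡b (sym y≡b)))
    ... | inj₂ (inj₁ x≡b)   | inj₂ (inj₂ y-leaf) = bound-from-b e∈ x≡b y-leaf
    ... | inj₂ (inj₂ x-leaf) | inj₁ y≡a          = bound-to-a e∈ x-leaf y≡a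
    ... | inj₂ (inj₂ x-leaf) | inj₂ (inj₁ y≡b)   = bound-to-b e∈ x-leaf y≡b
    ... | inj₂ (inj₂ x-leaf) | inj₂ (inj₂ y-leaf) = ⊥-elim (leaves-not-adjacent e∈ x-leaf y-leaf)

    σ : (Fin n → ℕ) → ℤ
    σ K = surplus cs K block

    ab-sum : + ∑ₗ abWeight cs ℤ.+ + ∑ₗ abWeight cs ℤ.≤ σ (keyAB 0) ℤ.+ σ (keyAB 4)
    ab-sum = subst₂ ℤ._≤_ (trans (∑ℤ-+ _ _ cs) (cong₂ ℤ._+_ (∑ℤ-ℕ abWeight cs) (∑ℤ-ℕ abWeight cs)))
                          (∑ℤ-+ _ _ cs)
                          (∑ℤ-mono cs (proj₁ ∘ edge-bound))

    leaf-sum : + ∑ₗ leafWeight cs ℤ.+ + ∑ₗ leafWeight cs ℤ.≤ (σ (keyAB 0) ℤ.+ σ (keyAB 4)) ℤ.+ (σ (keyBA 0) ℤ.+ σ (keyBA 4))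
    leaf-sum = subst₂ ℤ._≤_ (trans (∑ℤ-+ _ _ cs) (cong₂ ℤ._+_ (∑ℤ-ℕ leafWeight cs) (∑ℤ-ℕ leafWeight cs)))
                            (trans (∑ℤ-+ _ _ cs) (cong₂ ℤ._+_ (∑ℤ-+ _ _ cs) (∑ℤ-+ _ _ cs)))
                            (∑ℤ-mono cs (proj₂ ∘ edge-bound))

    ab-weight-positive : 1 ℕ.≤ ∑ₗ abWeight cs
    ab-weight-positive = ℕₚ.≤-trans (subst (1 ℕ.≤_) (sym e₀-weight) (positive e₀∈)) (∑ₗ-term abWeight e₀∈)
      where
      e₀-weight : abWeight e₀ ≡ weight e₀
      e₀-weight rewrite =?-refl a | =?-refl b = refl

    -- Each leaf meets a constraint inside S, and each constraint inside S
    -- meets at most one leaf; so there are at most ∑ leafWeight leaves.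
    atLeaf : Fin n → Constraint n → ℕ
    atLeaf u e = if leaf u ∧ (inside S e ∧ touches u e) then weight e else 0

    leaf-has-weight : ∀ u → ⟦ leaf u ⟧ ℕ.≤ ∑ₗ (atLeaf u) cs
    leaf-has-weight u with true-or-false (leaf u)
    ... | inj₂ not-leaf rewrite not-leaf = z≤n
    ... | inj₁ u-leaf with not-isolated⇒witness {S} {u} (leaf⇒not-isolated u-leaf)
    ...   | e , e∈ , at-u = subst (λ l → ⟦ l ⟧ ℕ.≤ ∑ₗ (atLeaf u) cs) (sym u-leaf)
      (ℕₚ.≤-trans (subst (1 ℕ.≤_) (sym full-weight) (positive e∈)) (∑ₗ-term (atLeaf u) e∈))
      where
      full-weight : atLeaf u e ≡ weight e
      full-weight = cong (λ c → if c then weight e else 0) (cong₂ _∧_ u-leaf at-u)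

    split-touch : ∀ l i p q w → (if l ∧ (i ∧ (p ∨ q)) then w else 0)
                                ℕ.≤ (if p then (if l ∧ i then w else 0) else 0) ℕ.+ (if q then (if l ∧ i then w else 0) else 0)
    split-touch false i     p     q     w = z≤n
    split-touch true  false p     q     w = z≤n
    split-touch true  true  true  q     w = ℕₚ.m≤m+n w _
    split-touch true  true  false true  w = ℕₚ.≤-refl
    split-touch true  true  false false w = z≤n

    weight-at-leaves : ∀ {e} → e ∈ cs → ∑ (λ u → atLeaf u e) ℕ.≤ leafWeight e
    weight-at-leaves {e} e∈ = ℕₚ.≤-trans (∑-mono-≤ (λ u → split-touch (leaf u) (inside S e) (u =? fst e) (u =? snd e) (weight e)))
                                (ℕₚ.≤-trans (ℕₚ.≤-reflexive ends) (at-most-one-leaf (leaf (fst e)) (leaf (snd e)) refl refl))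
      where
      f : Fin n → ℕ
      f u = if leaf u ∧ inside S e then weight e else 0
      ends : ∑ (λ u → (if u =? fst e then f u else 0) ℕ.+ (if u =? snd e then f u else 0)) ≡ f (fst e) ℕ.+ f (snd e)
      ends = trans (∑-distrib-+ (λ u → if u =? fst e then f u else 0) (λ u → if u =? snd e then f u else 0)) (cong₂ ℕ._+_ (∑-point (fst e) f) (∑-point (snd e) f))
      at-most-one-leaf : ∀ lx ly → leaf (fst e) ≡ lx → leaf (snd e) ≡ ly →
        (if lx ∧ inside S e then weight e else 0) ℕ.+ (if ly ∧ inside S e then weight e else 0)
        ℕ.≤ (if inside S e ∧ (lx ∨ ly) then weight e else 0)
      at-most-one-leaf true  true  x-leaf y-leaf = ⊥-elim (leaves-not-adjacent e∈ x-leaf y-leaf)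
      at-most-one-leaf true  false _ _ with inside S e
      ... | true  = ℕₚ.≤-reflexive (ℕₚ.+-identityʳ _)
      ... | false = z≤n
      at-most-one-leaf false true  _ _ with inside S e
      ... | true  = ℕₚ.≤-refl
      ... | false = z≤n
      at-most-one-leaf false false _ _ = z≤n

    leaves≤leafWeight : card leaf ℕ.≤ ∑ₗ leafWeight cs
    leaves≤leafWeight = begin
      card leaf                            ≤⟨ ∑-mono-≤ leaf-has-weight ⟩
      ∑ (λ u → ∑ₗ (atLeaf u) cs)           ≡⟨ ∑-∑ₗ-comm atLeaf cs ⟩
      ∑ₗ (λ e → ∑ (λ u → atLeaf u e)) cs   ≤⟨ ∑ₗ-mono cs weight-at-leaves ⟩
      ∑ₗ leafWeight cs                     ∎
      where open ℕₚ.≤-Reasoning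

    card-block : card block ≡ 2 ℕ.+ card leaf
    card-block = begin
      card block
        ≡⟨ sum-cong-≗ split ⟩
      ∑ (λ v → ⟦ v =? a ⟧ ℕ.+ (⟦ v =? b ⟧ ℕ.+ ⟦ leaf v ⟧))
        ≡⟨ ∑-distrib-+ (λ v → ⟦ v =? a ⟧) (λ v → ⟦ v =? b ⟧ ℕ.+ ⟦ leaf v ⟧) ⟩
      ∑ (λ v → ⟦ v =? a ⟧) ℕ.+ ∑ (λ v → ⟦ v =? b ⟧ ℕ.+ ⟦ leaf v ⟧)
        ≡⟨ cong₂ ℕ._+_ (∑-point a (λ _ → 1)) (∑-distrib-+ (λ v → ⟦ v =? b ⟧) (λ v → ⟦ leaf v ⟧)) ⟩
      1 ℕ.+ (∑ (λ v → ⟦ v =? b ⟧) ℕ.+ card leaf)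
        ≡⟨ cong (λ t → 1 ℕ.+ (t ℕ.+ card leaf)) (∑-point b (λ _ → 1)) ⟩
      2 ℕ.+ card leaf ∎
      where
      open ≡-Reasoning
      split : ∀ v → ⟦ block v ⟧ ≡ ⟦ v =? a ⟧ ℕ.+ (⟦ v =? b ⟧ ℕ.+ ⟦ leaf v ⟧)
      split v with true-or-false (v =? a) | true-or-false (v =? b) | true-or-false (leaf v)
      ... | inj₁ v≡a | inj₁ v≡b | _ = ⊥-elim (distinct e₀ (trans (sym (=?⇒≡ {x = v} v≡a)) (=?⇒≡ {x = v} v≡b)))
      ... | inj₁ v≡a | inj₂ v≢b | inj₁ v-leaf = ⊥-elim (leaf⇒≢a v-leaf (=?⇒≡ {x = v} v≡a))
      ... | inj₁ v≡a | inj₂ v≢b | inj₂ v-nonleaf rewrite v≡a | v≢b | v-nonleaf = refl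
      ... | inj₂ v≢a | inj₁ v≡b | inj₁ v-leaf = ⊥-elim (leaf⇒≢b v-leaf (=?⇒≡ {x = v} v≡b))
      ... | inj₂ v≢a | inj₁ v≡b | inj₂ v-nonleaf rewrite v≢a | v≡b | v-nonleaf = refl
      ... | inj₂ v≢a | inj₂ v≢b | _ rewrite v≢a | v≢b = refl

    -- The block lemma: the best of the four orderings has surplus at least
    -- a quarter of the size of the block, since twice its size is
    -- 4 + 2·#leaves ≤ 4·abWeight + 2·leafWeight ≤ 2(s₁ + s₂) + (s₁ + s₂ + s₃ + s₄).
    block-bound : ∃ λ K → + card block ℤ.≤ + 4 ℤ.* σ K
    block-bound with larger σ (keyAB 0) (keyAB 4) | larger σ (keyBA 0) (keyBA 4)
    ... | K₁ , s₁≤ , s₂≤ | K₂ , s₃≤ , s₄≤ with larger σ K₁ K₂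
    ... | K , K₁≤K , K₂≤K = K , halve _ _ twice-bound
      where
      open ℤₚ.≤-Reasoning
      A L s : ℤ
      A = + ∑ₗ abWeight cs
      L = + ∑ₗ leafWeight cs
      s = σ K
      1≤A : + 1 ℤ.≤ A
      1≤A = ℤ.+≤+ ab-weight-positive
      ℓ≤L : + card leaf ℤ.≤ L
      ℓ≤L = ℤ.+≤+ leaves≤leafWeight
      le₁ : σ (keyAB 0) ℤ.≤ s
      le₁ = ℤₚ.≤-trans s₁≤ K₁≤K
      le₂ : σ (keyAB 4) ℤ.≤ s
      le₂ = ℤₚ.≤-trans s₂≤ K₁≤K
      le₃ : σ (keyBA 0) ℤ.≤ s
      le₃ = ℤₚ.≤-trans s₃≤ K₂≤K
      le₄ : σ (keyBA 4) ℤ.≤ s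
      le₄ = ℤₚ.≤-trans s₄≤ K₂≤K
      regroup : ∀ o ℓ → (o ℤ.+ (o ℤ.+ ℓ)) ℤ.+ (o ℤ.+ (o ℤ.+ ℓ)) ≡ ((o ℤ.+ o) ℤ.+ (o ℤ.+ o)) ℤ.+ (ℓ ℤ.+ ℓ)
      regroup = solve-∀
      eight : ∀ x → ((x ℤ.+ x) ℤ.+ (x ℤ.+ x)) ℤ.+ ((x ℤ.+ x) ℤ.+ (x ℤ.+ x)) ≡ + 4 ℤ.* x ℤ.+ + 4 ℤ.* x
      eight = solve-∀
      twice-bound : + card block ℤ.+ + card block ℤ.≤ + 4 ℤ.* s ℤ.+ + 4 ℤ.* s
      twice-bound = begin
        + card block ℤ.+ + card block
          ≡⟨ cong (λ c → + c ℤ.+ + c) card-block ⟩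
        + (1 ℕ.+ (1 ℕ.+ card leaf)) ℤ.+ + (1 ℕ.+ (1 ℕ.+ card leaf))
          ≡⟨ regroup (+ 1) (+ card leaf) ⟩
        ((+ 1 ℤ.+ + 1) ℤ.+ (+ 1 ℤ.+ + 1)) ℤ.+ (+ card leaf ℤ.+ + card leaf)
          ≤⟨ ℤₚ.+-mono-≤ (ℤₚ.+-mono-≤ (ℤₚ.+-mono-≤ 1≤A 1≤A) (ℤₚ.+-mono-≤ 1≤A 1≤A)) (ℤₚ.+-mono-≤ ℓ≤L ℓ≤L) ⟩
        ((A ℤ.+ A) ℤ.+ (A ℤ.+ A)) ℤ.+ (L ℤ.+ L)
          ≤⟨ ℤₚ.+-mono-≤ (ℤₚ.+-mono-≤ ab-sum ab-sum) leaf-sum ⟩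
        ((σ (keyAB 0) ℤ.+ σ (keyAB 4)) ℤ.+ (σ (keyAB 0) ℤ.+ σ (keyAB 4)))
          ℤ.+ ((σ (keyAB 0) ℤ.+ σ (keyAB 4)) ℤ.+ (σ (keyBA 0) ℤ.+ σ (keyBA 4)))
          ≤⟨ ℤₚ.+-mono-≤ (ℤₚ.+-mono-≤ (ℤₚ.+-mono-≤ le₁ le₂) (ℤₚ.+-mono-≤ le₁ le₂))
                         (ℤₚ.+-mono-≤ (ℤₚ.+-mono-≤ le₁ le₂) (ℤₚ.+-mono-≤ le₃ le₄)) ⟩
        ((s ℤ.+ s) ℤ.+ (s ℤ.+ s)) ℤ.+ ((s ℤ.+ s) ℤ.+ (s ℤ.+ s))
          ≡⟨ eight s ⟩
        + 4 ℤ.* s ℤ.+ + 4 ℤ.* s ∎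

    rest⇒S : ∀ {v} → rest v ≡ true → S v ≡ true
    rest⇒S {v} p = proj₁ (∧-split (S v) p)

    block-not-isolated : ∀ {v} → block v ≡ true → isolated S v ≡ false
    block-not-isolated {v} v∈B with block-cases v∈B
    ... | inj₂ (inj₂ v-leaf) = leaf⇒not-isolated v-leaf
    ... | inj₁ v≡a = not-isolated {S} {v} e₀∈ (cong₂ _∧_ (cong₂ _∧_ Sa Sb) (touches-end {v} {e₀} (inj₁ v≡a)))
    ... | inj₂ (inj₁ v≡b) = not-isolated {S} {v} e₀∈ (cong₂ _∧_ (cong₂ _∧_ Sa Sb) (touches-end {v} {e₀} (inj₂ v≡b)))

    Joins : Constraint n → Fin n → Fin n → Set
    Joins e v w = (v ≡ fst e × w ≡ snd e) ⊎ (v ≡ snd e × w ≡ fst e)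

    joins-touches : ∀ {e v w} → Joins e v w → touches v e ≡ true
    joins-touches {e} (inj₁ (refl , _)) = touches-fst e
    joins-touches {e} (inj₂ (refl , _)) = touches-snd e

    joins-partner : ∀ {e v w} → Joins e v w → w ≡ fst e ⊎ w ≡ snd e
    joins-partner (inj₁ (_ , w≡y)) = inj₂ w≡y
    joins-partner (inj₂ (_ , w≡x)) = inj₁ w≡x

    joins-inside : ∀ {T e v w} → Joins e v w → T v ≡ true → T w ≡ true → inside T e ≡ true
    joins-inside (inj₁ (refl , refl)) Tv Tw = cong₂ _∧_ Tv Tw
    joins-inside (inj₂ (refl , refl)) Tv Tw = cong₂ _∧_ Tw Tv

    joins-end : ∀ {T e v w} → Joins e v w → inside T e ≡ true → T w ≡ true
    joins-end {T} {e} (inj₁ (_ , refl)) e-in = proj₂ (∧-split (T (fst e)) e-in)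
    joins-end {T} {e} (inj₂ (_ , refl)) e-in = proj₁ (∧-split (T (fst e)) e-in)

    joins-ab : ∀ {e v w} → Joins e v w → (fst e ≡ a ⊎ fst e ≡ b) ⊎ (snd e ≡ a ⊎ snd e ≡ b) →
               (v ≡ a ⊎ v ≡ b) ⊎ (w ≡ a ⊎ w ≡ b)
    joins-ab (inj₁ (refl , refl)) ends = ends
    joins-ab (inj₂ (refl , refl)) ends = Data.Sum.swap ends

    module OutsideVertex {v} (Sv : S v ≡ true) (v∉B : block v ≡ false) (iso-rest : isolated rest v ≡ true) where

      v∉ab : v ≡ a ⊎ v ≡ b → ⊥
      v∉ab v∈ab = case trans (sym (block-ab v∈ab)) v∉B of λ ()

      partner-in-ab : ∀ {e w} → e ∈ cs → inside S e ≡ true → Joins e v w → w ≡ a ⊎ w ≡ b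
      partner-in-ab {e} {w} e∈ e-in vw with true-or-false (block w)
      ... | inj₂ w∉B = ⊥-elim (case trans (sym iso-rest) (not-isolated {rest} {v} e∈ in-rest) of λ ())
        where
        rest-w : rest w ≡ true
        rest-w = cong₂ _∧_ (joins-end {S} {e} {v} {w} vw e-in) (cong not w∉B)
        rest-v : rest v ≡ true
        rest-v = cong₂ _∧_ Sv (cong not v∉B)
        in-rest : inside rest e ∧ touches v e ≡ true
        in-rest = cong₂ _∧_ (joins-inside {rest} {e} {v} {w} vw rest-v rest-w) (joins-touches {e} {v} {w} vw)
      ... | inj₁ w∈B with block-cases {w} w∈B
      ...   | inj₁ w≡a = inj₁ w≡a
      ...   | inj₂ (inj₁ w≡b) = inj₂ w≡b
      ...   | inj₂ (inj₂ w-leaf) with joins-ab {e} {v} {w} vw (leaf-neighbour e∈ w-leaf e-in (joins-partner {e} {v} {w} vw))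
      ...     | inj₁ v∈ab = ⊥-elim (v∉ab v∈ab)
      ...     | inj₂ w∈ab = ⊥-elim (leaf∉ab w-leaf w∈ab)

      confined-v : ∀ {e} → e ∈ cs → confined v e ≡ true
      confined-v {e} e∈ with true-or-false (inside S e ∧ touches v e)
      ... | inj₂ away = cong (λ c → not c ∨ (near v (fst e) ∧ near v (snd e))) away
      ... | inj₁ at-v with ∧-split (inside S e) at-v
      ...   | e-in , v-touches = trans (cong (λ c → not c ∨ (near v (fst e) ∧ near v (snd e))) at-v) ends-near
        where
        ends-near : near v (fst e) ∧ near v (snd e) ≡ true
        ends-near with touches⇒endpoint {v} {e} v-touches
        ... | inj₁ refl = cong₂ _∧_ (near-self v) (near-ab (partner-in-ab e∈ e-in (inj₁ (refl , refl))))
        ... | inj₂ refl = cong₂ _∧_ (near-ab (partner-in-ab e∈ e-in (inj₂ (refl , refl)))) (near-self v)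

      -- It was already isolated in S: otherwise it would be a leaf.
      isolated-in-S : isolated S v ≡ true
      isolated-in-S with true-or-false (isolated S v)
      ... | inj₁ iso = iso
      ... | inj₂ ¬iso = ⊥-elim (case trans (sym (block-leaf v-leaf)) v∉B of λ ())
        where
        v-leaf : leaf v ≡ true
        v-leaf = leaf-intro Sv (v∉ab ∘ inj₁) (v∉ab ∘ inj₂) ¬iso confined-v

    rest-not-isolated : ∀ {v} → isolated rest v ≡ false → isolated S v ≡ false
    rest-not-isolated {v} ¬iso with not-isolated⇒witness {rest} {v} ¬iso
    ... | e , e∈ , at-v with ∧-split (inside rest e) at-v
    ...   | e-in , v-touches with ∧-split (rest (fst e)) e-in
    ...     | x∈R , y∈R = not-isolated {S} {v} e∈ (cong₂ _∧_ (cong₂ _∧_ (rest⇒S x∈R) (rest⇒S y∈R)) v-touches)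

    isolated-preserved : ∀ v → (S v ∧ isolated S v) ≡ (rest v ∧ isolated rest v)
    isolated-preserved v with true-or-false (S v) | true-or-false (block v)
    ... | inj₂ v∉S | _ rewrite v∉S = refl
    ... | inj₁ Sv | inj₁ v∈B =
      trans (cong₂ _∧_ Sv (block-not-isolated {v} v∈B)) (sym (cong (_∧ isolated rest v) (cong₂ _∧_ Sv (cong not v∈B))))
    ... | inj₁ Sv | inj₂ v∉B with true-or-false (isolated rest v)
    ...   | inj₁ iso-rest = trans (cong₂ _∧_ Sv (OutsideVertex.isolated-in-S Sv v∉B iso-rest))
                                  (sym (cong₂ _∧_ (cong₂ _∧_ Sv (cong not v∉B)) iso-rest))
    ...   | inj₂ ¬iso-rest = trans (cong₂ _∧_ Sv (rest-not-isolated {v} ¬iso-rest))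
                                   (sym (cong₂ _∧_ (cong₂ _∧_ Sv (cong not v∉B)) ¬iso-rest))

    S≡block∪rest : ∀ v → S v ≡ block v ∨ rest v
    S≡block∪rest v with true-or-false (block v)
    ... | inj₁ v∈B = trans (block⇒S v∈B) (sym (cong (_∨ rest v) v∈B))
    ... | inj₂ v∉B = sym (trans (cong (λ c → c ∨ (S v ∧ not c)) v∉B) (∧-identityʳ (S v)))

    block∩rest=∅ : ∀ v → block v ≡ true → rest v ≡ false
    block∩rest=∅ v v∈B = trans (cong (λ c → S v ∧ not c) v∈B) (∧-zeroʳ (S v))

    card-split : card S ≡ card block ℕ.+ card rest
    card-split = trans (sum-cong-≗ split) (∑-distrib-+ (λ v → ⟦ block v ⟧) (λ v → ⟦ rest v ⟧))
      where
      split : ∀ v → ⟦ S v ⟧ ≡ ⟦ block v ⟧ ℕ.+ ⟦ rest v ⟧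
      split v with true-or-false (block v)
      ... | inj₁ v∈B = trans (cong ⟦_⟧ (block⇒S v∈B))
                             (sym (cong₂ ℕ._+_ (cong ⟦_⟧ v∈B) (cong ⟦_⟧ (block∩rest=∅ v v∈B))))
      ... | inj₂ v∉B = sym (trans (cong₂ ℕ._+_ (cong ⟦_⟧ v∉B) (cong (λ c → ⟦ S v ∧ not c ⟧) v∉B))
                                  (cong ⟦_⟧ (∧-identityʳ (S v))))

  isolatedCount : (Fin n → Bool) → ℕ
  isolatedCount S = card (λ v → S v ∧ isolated S v)

  Good : (Fin n → Bool) → (Fin n → ℕ) → Set
  Good S K = + card S ℤ.≤ + 4 ℤ.* surplus cs K S ℤ.+ + isolatedCount S

  good-without-constraints : ∀ S (K : Fin n → ℕ) → any (inside S) cs ≡ false → Good S K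
  good-without-constraints S K none =
    subst₂ (λ s i → + card S ℤ.≤ + 4 ℤ.* s ℤ.+ + i) (sym no-surplus) (sym all-isolated) ℤₚ.≤-refl
    where
    no-surplus : surplus cs K S ≡ + 0
    no-surplus = trans (∑ℤ-cong cs (λ {e} e∈ → contribution-outside K S e (any-false {p = inside S} none e∈))) (∑ℤ-zero cs)
    isolated-everywhere : ∀ v → isolated S v ≡ true
    isolated-everywhere v = cong not (any-none cs (λ {e} e∈ → cong (_∧ touches v e) (any-false none e∈)))
    all-isolated : isolatedCount S ≡ card S
    all-isolated = sum-cong-≗ (λ v → cong ⟦_⟧ (trans (cong (S v ∧_) (isolated-everywhere v)) (∧-identityʳ (S v))))

  -- Induction on an upper bound m for |S|: split off the block of a
  -- constraint inside S, order the rest by induction and concatenate.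
  good-ordering : ∀ m S → card S ℕ.≤ m → ∃ (Good S)
  good-ordering m S |S|≤m with true-or-false (any (inside S) cs)
  ... | inj₂ none = (λ _ → 0) , good-without-constraints S (λ _ → 0) none
  ... | inj₁ some with any-elim cs some | m
  ...   | e₀ , e₀∈ , e₀-in | zero =
    ⊥-elim (ℕₚ.<-irrefl refl (ℕₚ.≤-trans (subst (ℕ._≤ card S) (cong ⟦_⟧ (proj₁ (∧-split (S (fst e₀)) e₀-in)))
                                                 (∑-term (λ v → ⟦ S v ⟧) (fst e₀)))
                                         |S|≤m))
  ...   | e₀ , e₀∈ , e₀-in | suc m′ = K , good
    where
    open Block S e₀ e₀∈ (proj₁ (∧-split (S (fst e₀)) e₀-in)) (proj₂ (∧-split (S (fst e₀)) e₀-in))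
    |rest|<|S| : card rest ℕ.< card S
    |rest|<|S| = subst (card rest ℕ.<_) (sym (trans card-split (cong (ℕ._+ card rest) card-block)))
                       (s≤s (ℕₚ.m≤n+m (card rest) (1 ℕ.+ card leaf)))
    rest-good : ∃ (Good rest)
    rest-good = good-ordering m′ rest (ℕₚ.≤-pred (ℕₚ.≤-trans |rest|<|S| |S|≤m))
    KB KR : Fin n → ℕ
    KB = proj₁ block-bound
    KR = proj₁ rest-good
    joined : ∃ λ K → surplus cs KB block ℤ.+ surplus cs KR rest ℤ.≤ surplus cs K S
    joined = concatenation cs block rest S S≡block∪rest block∩rest=∅ KB KR
    K : Fin n → ℕ
    K = proj₁ joined
    same-isolated : isolatedCount S ≡ isolatedCount rest
    same-isolated = sum-cong-≗ (λ v → cong ⟦_⟧ (isolated-preserved v))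
    distribute : ∀ x y i → + 4 ℤ.* x ℤ.+ (+ 4 ℤ.* y ℤ.+ i) ≡ + 4 ℤ.* (x ℤ.+ y) ℤ.+ i
    distribute = solve-∀
    good : Good S K
    good = begin
      + card S
        ≡⟨ cong +_ card-split ⟩
      + card block ℤ.+ + card rest
        ≤⟨ ℤₚ.+-mono-≤ (proj₂ block-bound) (proj₂ rest-good) ⟩
      + 4 ℤ.* surplus cs KB block ℤ.+ (+ 4 ℤ.* surplus cs KR rest ℤ.+ + isolatedCount rest)
        ≡⟨ distribute (surplus cs KB block) (surplus cs KR rest) (+ isolatedCount rest) ⟩
      + 4 ℤ.* (surplus cs KB block ℤ.+ surplus cs KR rest) ℤ.+ + isolatedCount rest
        ≤⟨ ℤₚ.+-mono-≤ (ℤₚ.*-monoˡ-≤-nonNeg (+ 4) (proj₂ joined)) (ℤₚ.≤-reflexive (cong +_ (sym same-isolated))) ⟩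
      + 4 ℤ.* surplus cs K S ℤ.+ + isolatedCount S ∎
      where open ℤₚ.≤-Reasoning

-- A strict ordering of surplus at least 2k witnesses a yes-instance: its
-- linear ordering satisfies weight (W + surplus)/2 ≥ W/2 + k.
yes-from-surplus : ∀ I (K : Fin (n I) → ℕ.ℕ) (K-injective : Injective _≡_ _≡_ K) →
                   + (2 ℕ.* k I) ℤ.≤ surplus (cs I) K (λ _ → true) → YesInstance I
yes-from-surplus I K K-injective 2k≤s = ordering , ℤₚ.drop‿+≤+ (begin
  + (W ℕ.+ 2 ℕ.* k I)                      ≡⟨ ℤₚ.pos-+ W (2 ℕ.* k I) ⟩
  + W ℤ.+ + (2 ℕ.* k I)                    ≤⟨ ℤₚ.+-monoʳ-≤ (+ W) 2k≤s ⟩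
  + W ℤ.+ surplus (cs I) K (λ _ → true)     ≡⟨ twice-satWeight (cs I) ⟩
  + sat ℤ.+ + sat                          ≡⟨ ℤₚ.pos-+ sat sat ⟨
  + (sat ℕ.+ sat)                          ≡⟨ cong (λ t → + (sat ℕ.+ t)) (ℕₚ.+-identityʳ sat) ⟨
  + (2 ℕ.* sat)                            ∎)
  where
  open ℤₚ.≤-Reasoning
  open StrictOrderings.Ranking K K-injective
  open StrictOrderings.Agreement ordering K K-injective ordering-reflects ordering-preserves
  W sat : ℕ.ℕ
  W = totalWeight (cs I)
  sat = satWeight ordering (cs I)

quarter : ∀ {k m} (s : ℤ) → 10 ℕ.* k ℕ.≤ m → + m ℤ.≤ + 4 ℤ.* s → + (2 ℕ.* k) ℤ.≤ s
quarter {k} {m} s 10k≤m m≤4s = ℤₚ.*-cancelˡ-≤-pos (+ (2 ℕ.* k)) s (+ 4) (begin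
  + 4 ℤ.* + (2 ℕ.* k)  ≡⟨ ℤₚ.pos-* 4 (2 ℕ.* k) ⟨
  + (4 ℕ.* (2 ℕ.* k))  ≤⟨ ℤ.+≤+ 8k≤10k ⟩
  + (10 ℕ.* k)         ≤⟨ ℤ.+≤+ 10k≤m ⟩
  + m                  ≤⟨ m≤4s ⟩
  + 4 ℤ.* s            ∎)
  where
  open ℤₚ.≤-Reasoning
  8k≤10k : 4 ℕ.* (2 ℕ.* k) ℕ.≤ 10 ℕ.* k
  8k≤10k = subst (ℕ._≤ 10 ℕ.* k) (ℕₚ.*-assoc 4 2 k) (ℕₚ.*-monoˡ-≤ k (ℕₚ.m≤m+n 8 2))

module Irreducibility (I : Instance) (irreducible : Irreducible I) where

  no-opposite : ∀ {e₁ e₂} → e₁ ∈ cs I → e₂ ∈ cs I → fst e₂ ≡ snd e₁ → snd e₂ ≡ fst e₁ → ⊥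
  no-opposite e₁∈ e₂∈ p q = proj₂ (proj₂ irreducible) (index e₁∈) (index e₂∈)
    ( trans (cong fst (sym (lookup-index e₂∈))) (trans p (cong snd (lookup-index e₁∈)))
    , trans (cong snd (sym (lookup-index e₂∈))) (trans q (cong fst (lookup-index e₁∈))))

  positive : ∀ {e} → e ∈ cs I → 1 ℕ.≤ weight e
  positive e∈ = subst (λ e → 1 ℕ.≤ weight e) (sym (lookup-index e∈))
                      (ℕ.>-nonZero⁻¹ _ {{proj₂ (proj₁ irreducible) (index e∈)}})

  open Blocks (cs I) no-opposite positive

  full : Fin (n I) → Bool
  full _ = true

  none-isolated : isolatedCount full ≡ 0
  none-isolated = ∑-zero _ (λ v → cong ⟦_⟧ (occurs v))
    where
    occurs : ∀ v → isolated full v ≡ false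
    occurs v with proj₁ (proj₁ irreducible) v
    ... | i , v-end = not-isolated {full} {v} (∈-lookup i)
                                   (touches-end {v} {lookup (cs I) i} (Data.Sum.map sym sym v-end))

  large-surplus : ∃ λ K → Injective _≡_ _≡_ K × + n I ℤ.≤ + 4 ℤ.* surplus (cs I) K full
  large-surplus with good-ordering (card full) full ℕₚ.≤-refl
  ... | K , K-good with TieBreaking.tieBreak K (cs I) full
  ...   | K* , K*-injective , K≤K* = K* , K*-injective , (begin
    + n I                                                      ≡⟨ cong +_ (card-full (n I)) ⟨
    + card full                                                ≤⟨ K-good ⟩
    + 4 ℤ.* surplus (cs I) K full ℤ.+ + isolatedCount full     ≡⟨ cong (λ i → + 4 ℤ.* surplus (cs I) K full ℤ.+ + i) none-isolated ⟩
    + 4 ℤ.* surplus (cs I) K full ℤ.+ + 0                      ≡⟨ ℤₚ.+-identityʳ _ ⟩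
    + 4 ℤ.* surplus (cs I) K full                              ≤⟨ ℤₚ.*-monoˡ-≤-nonNeg (+ 4) K≤K* ⟩
    + 4 ℤ.* surplus (cs I) K* full                             ∎)
    where open ℤₚ.≤-Reasoning

  yes-instance : 10 ℕ.* k I ℕ.≤ n I → YesInstance I
  yes-instance 10k≤n =
    let (K , K-injective , n≤4s) = large-surplus
    in  yes-from-surplus I K K-injective (quarter {k I} {n I} (surplus (cs I) K full) 10k≤n n≤4s)

open import Data.Nat using (_*_; _<_)

corollary3 : (I : Instance) → Irreducible I → NoInstance I → n I < 10 * k I
corollary3 I irreducible no-instance with 10 * k I ℕ.≤? n I
... | no 10k≰n  = ℕₚ.≰⇒> 10k≰n
... | yes 10k≤n = ⊥-elim (no-instance (Irreducibility.yes-instance I irreducible 10k≤n))
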